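{- Let $(N,\preceq,F)$ be a transitive-closed description of a simply dependent multimodal logic. Then the linear nested sequent calculus $\mathsf{LNS}_{(N,\preceq,F)}$ extended with contraction and weakening is sound and complete for $\mathcal{L}_{(N,\preceq,F)}$: for every formula $A$, $A\in\mathcal{L}_{(N,\preceq,F)}$ if and only if the linear nested sequent $\;\Rightarrow A$ (one component) is derivable in this calculus.
   Context: A description is a triple $(N,\preceq,F)$ with $N$ a finite set of natural numbers, $\preceq$ a partial order on $N$, and each $F(i)$ the extension of modal logic $\mathsf{K}$ by some subset of $\mathsf{D}: \neg\Box\bot$, $\mathsf{T}: \Box A\to A$, $\mathsf{4}: \Box A\to\Box\Box A$; $\mathsf{KAx}\subseteq F(i)$ means $F(i)$ proves all theorems of $\mathsf{K}+\mathsf{Ax}$. Formulas are built from propositional variables, $\bot,\top,\neg,\land,\lor,\to$ and $\Box_i$ ($i\in N$). $\mathcal{L}_{(N,\preceq,F)}$ is the smallest set of formulas containing the propositional tautologies, $\Box_i(A\to B)\to(\Box_iA\to\Box_iB)$ and the $\Box_i$-instances of the extra axioms of $F(i)$ for each $i$, and $\Box_jA\to\Box_iA$ whenever $i\preceq j$, closed under modus ponens and necessitation for each $\Box_i$. Transitive-closed: $i\preceq j$ and $\mathsf{K4}\subseteq F(i)$ imply $\mathsf{K4}\subseteq F(j)$. Standing assumption of the paper: for $i\preceq j$, $\mathsf{KD}\subseteq F(i)\Rightarrow\mathsf{KD}\subseteq F(j)$ and $\mathsf{KT}\subseteq F(i)\Rightarrow\mathsf{KT}\subseteq F(j)$. A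 linear nested sequent is a finite nonempty list $\Gamma_1\Rightarrow\Delta_1\,/_{i_1}\,\Gamma_2\Rightarrow\Delta_2\,/_{i_2}\cdots/_{i_{n-1}}\,\Gamma_n\Rightarrow\Delta_n$ of sequents (components; each $\Gamma_k,\Delta_k$ a finite multiset of formulas) separated by nesting operators $/_i$ with $i\in N$. $\mathcal{S}\{\Gamma\Rightarrow\Delta\}$ denotes a linear nested sequent with a distinguished component $\Gamma\Rightarrow\Delta$, and $\mathcal{G}\,/_k\,\Gamma\Rightarrow\Delta$ denotes one whose last component is $\Gamma\Rightarrow\Delta$ (the prefix $\mathcal{G}\,/_k$ may be empty). Propositional rules (applicable in any component, rest unchanged): zero-premiss rules $\mathcal{S}\{\Gamma,p\Rightarrow p,\Delta\}$ ($p$ atomic), $\mathcal{S}\{\Gamma,\bot\Rightarrow\Delta\}$, $\mathcal{S}\{\Gamma\Rightarrow\top,\Delta\}$; and the standard two-sided rules for $\neg,\lor,\land,\to$ inside $\mathcal{S}\{\cdot\}$: $\neg_L$ ($\mathcal{S}\{\Gamma\Rightarrow A,\Delta\}$ / $\mathcal{S}\{\Gamma,\neg A\Rightarrow\Delta\}$), $\neg_R$ ($\mathcal{S}\{\Gamma,A\Rightarrow\Delta\}$ / $\mathcal{S}\{\Gamma\Rightarrow\neg A,\Delta\}$), $\lor_L$ (premisses $\mathcal{S}\{\Gamma,A\Rightarrow\Delta\}$, $\mathcal{S}\{\Gamma,B\Rightarrow\Delta\}$), $\lor_R$ (premiss $\mathcal{S}\{\Gamma\Rightarrow A,B,\Delta\}$),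 $\land_L$ (premiss $\mathcal{S}\{\Gamma,A,B\Rightarrow\Delta\}$), $\land_R$ (premisses $\mathcal{S}\{\Gamma\Rightarrow A,\Delta\}$, $\mathcal{S}\{\Gamma\Rightarrow B,\Delta\}$), $\to_L$ (premisses $\mathcal{S}\{\Gamma,B\Rightarrow\Delta\}$, $\mathcal{S}\{\Gamma\Rightarrow A,\Delta\}$), $\to_R$ (premiss $\mathcal{S}\{\Gamma,A\Rightarrow B,\Delta\}$). Contraction and weakening: the usual left/right rules applied inside any component. Modal rules of $\mathsf{LNS}_{(N,\preceq,F)}$: $(\Box_{ij})_L$ for $j\preceq i$: from $\mathcal{S}\{\Gamma\Rightarrow\Delta\,/_j\,\Sigma,A\Rightarrow\Pi\}$ infer $\mathcal{S}\{\Gamma,\Box_iA\Rightarrow\Delta\,/_j\,\Sigma\Rightarrow\Pi\}$; $(\Box_i)_R$ for every $i$: from $\mathcal{G}/_k\Gamma\Rightarrow\Delta\,/_i\,\Rightarrow A$ infer $\mathcal{G}/_k\Gamma\Rightarrow\Delta,\Box_iA$; $\mathsf{d}_{ij}$ for $j\preceq i$ with $\mathsf{KD}\subseteq F(j)$: from $\mathcal{G}/_k\Gamma\Rightarrow\Delta\,/_j\,A\Rightarrow\;$ infer $\mathcal{G}/_k\Gamma,\Box_iA\Rightarrow\Delta$; $\mathsf{t}_i$ for $\mathsf{KT}\subseteq F(i)$: from $\mathcal{S}\{\Gamma,A\Rightarrow\Delta\}$ infer $\mathcal{S}\{\Gamma,\Box_iA\Rightarrow\Delta\}$; $\mathsf{4}_{ij}$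 for $j\preceq i$ with $\mathsf{K4}\subseteq F(i)$: from $\mathcal{S}\{\Gamma\Rightarrow\Delta\,/_j\,\Sigma,\Box_iA\Rightarrow\Pi\}$ infer $\mathcal{S}\{\Gamma,\Box_iA\Rightarrow\Delta\,/_j\,\Sigma\Rightarrow\Pi\}$. A derivation is a finite tree of rule applications whose leaves are zero-premiss rules. -}

module Defs where

open import Data.Nat using (ℕ)
open import Data.Bool using (Bool; true; false; not; _∧_; _∨_)
open import Data.Unit using (⊤; tt)
open import Data.Empty using (⊥)
open import Data.Product using (Σ; _×_; _,_)
open import Data.List using (List; []; _∷_)
open import Data.List.Membership.Propositional using (_∈_)
open import Data.List.Relation.Unary.Unique.Propositional using (Unique)
open import Data.List.Relation.Binary.Permutation.Propositional using (_↭_)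
open import Relation.Binary.PropositionalEquality using (_≡_)
open import Relation.Binary.Structures using (IsPartialOrder)

infix 12 ¬'_
infixr 11 _∧'_
infixr 10 _∨'_
infixr 9 _⇒'_
infix 1 _⇒_

data Fm (I : Set) : Set where
  var  : ℕ → Fm I
  ⊥'   : Fm I
  ⊤'   : Fm I
  ¬'_  : Fm I → Fm I
  _∧'_ : Fm I → Fm I → Fm I
  _∨'_ : Fm I → Fm I → Fm I
  _⇒'_ : Fm I → Fm I → Fm I
  □    : I → Fm I → Fm I

-- Boolean evaluation treating propositional variables and boxed
-- formulas as atoms.
eval : {I : Set} → (ℕ → Bool) → (I → Fm I → Bool) → Fm I → Bool
eval v w (var p)  = v p
eval v w ⊥'       = false
eval v w ⊤'       = true
eval v w (¬' A)   = not (eval v w A)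
eval v w (A ∧' B) = eval v w A ∧ eval v w B
eval v w (A ∨' B) = eval v w A ∨ eval v w B
eval v w (A ⇒' B) = not (eval v w A) ∨ eval v w B
eval v w (□ i A)  = w i A

Tautology : {I : Set} → Fm I → Set
Tautology A = ∀ v w → eval v w A ≡ true

-- A subset of {D, T, 4}: the extra axioms of F(i) over K

record AxSet : Set where
  field
    hasD : Bool
    hasT : Bool
    has4 : Bool
open AxSet public

onlyD onlyT only4 : AxSet
onlyD = record { hasD = true  ; hasT = false ; has4 = false }
onlyT = record { hasD = false ; hasT = true  ; has4 = false }
only4 = record { hasD = false ; hasT = false ; has4 = true  }

data HThm {I : Set} (_≤_ : I → I → Set) (F : I → AxSet) : Fm I → Set where
  taut : ∀ {A} → Tautology A → HThm _≤_ F A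
  axK  : ∀ i A B → HThm _≤_ F (□ i (A ⇒' B) ⇒' (□ i A ⇒' □ i B))
  axD  : ∀ i → hasD (F i) ≡ true → HThm _≤_ F (¬' (□ i ⊥'))
  axT  : ∀ i A → hasT (F i) ≡ true → HThm _≤_ F (□ i A ⇒' A)
  ax4  : ∀ i A → has4 (F i) ≡ true → HThm _≤_ F (□ i A ⇒' □ i (□ i A))
  incl : ∀ i j A → i ≤ j → HThm _≤_ F (□ j A ⇒' □ i A)
  mp   : ∀ {A B} → HThm _≤_ F (A ⇒' B) → HThm _≤_ F A → HThm _≤_ F B
  nec  : ∀ i {A} → HThm _≤_ F A → HThm _≤_ F (□ i A)

NoRel : ⊤ → ⊤ → Set
NoRel _ _ = ⊥

MonoThm : AxSet → Fm ⊤ → Set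
MonoThm ax = HThm NoRel (λ _ → ax)

_⊆ᴸ_ : AxSet → AxSet → Set
ax ⊆ᴸ ax' = ∀ A → MonoThm ax A → MonoThm ax' A

record Description : Set₁ where
  field
    N      : List ℕ
    N-uniq : Unique N
  Idx : Set
  Idx = Σ ℕ (λ i → i ∈ N)
  field
    _⪯_  : Idx → Idx → Set
    ⪯-po : IsPartialOrder _≡_ _⪯_
    F    : Idx → AxSet

module _ (𝒟 : Description) where
  open Description 𝒟

  KD⊆ KT⊆ K4⊆ : Idx → Set
  KD⊆ i = onlyD ⊆ᴸ F i
  KT⊆ i = onlyT ⊆ᴸ F i
  K4⊆ i = only4 ⊆ᴸ F i

  TransitiveClosed : Set
  TransitiveClosed = ∀ i j → i ⪯ j → K4⊆ i → K4⊆ j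

  -- standing assumption of the paper (simply dependent descriptions)
  StandingAssumption : Set
  StandingAssumption = ∀ i j → i ⪯ j → (KD⊆ i → KD⊆ j) × (KT⊆ i → KT⊆ j)

  𝓛 : Fm Idx → Set
  𝓛 = HThm _⪯_ F

record Seq (I : Set) : Set where
  constructor _⇒_
  field
    ant : List (Fm I)
    suc : List (Fm I)

data LNS (I : Set) : Set where
  last  : Seq I → LNS I
  _/[_]_ : Seq I → I → LNS I → LNS I

ctx : {I : Set} → List (Seq I × I) → LNS I → LNS I
ctx []             t = t
ctx ((s , i) ∷ ps) t = s /[ i ] ctx ps t

_⊕_ : {I : Set} → Seq I → List (I × Seq I) → LNS I
s ⊕ []             = last s
s ⊕ ((i , t) ∷ ts) = s /[ i ] (t ⊕ ts)

Pre Suf : Set → Set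
Pre I = List (Seq I × I)
Suf I = List (I × Seq I)

S : {I : Set} → Pre I → Seq I → Suf I → LNS I
S p X q = ctx p (X ⊕ q)

S₂ : {I : Set} → Pre I → Seq I → I → Seq I → Suf I → LNS I
S₂ p X j Y q = ctx p (X /[ j ] (Y ⊕ q))

G : {I : Set} → Pre I → Seq I → LNS I
G p X = ctx p (last X)

-- The calculus LNS_(N,⪯,F) extended with contraction and weakening.
-- Multisets are represented by lists; the rule `ex` identifies lists
-- up to permutation (i.e. makes them multisets).

module _ (𝒟 : Description) where
  open Description 𝒟

  data ⊢ : LNS Idx → Set where
    ex   : ∀ {p q Γ Γ' Δ Δ'} → Γ ↭ Γ' → Δ ↭ Δ' →
           ⊢ (S p (Γ ⇒ Δ) q) → ⊢ (S p (Γ' ⇒ Δ') q)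
    init : ∀ {p q Γ Δ} n → ⊢ (S p (var n ∷ Γ ⇒ var n ∷ Δ) q)
    ⊥L   : ∀ {p q Γ Δ} → ⊢ (S p (⊥' ∷ Γ ⇒ Δ) q)
    ⊤R   : ∀ {p q Γ Δ} → ⊢ (S p (Γ ⇒ ⊤' ∷ Δ) q)
    ¬L   : ∀ {p q Γ Δ A} → ⊢ (S p (Γ ⇒ A ∷ Δ) q) → ⊢ (S p (¬' A ∷ Γ ⇒ Δ) q)
    ¬R   : ∀ {p q Γ Δ A} → ⊢ (S p (A ∷ Γ ⇒ Δ) q) → ⊢ (S p (Γ ⇒ ¬' A ∷ Δ) q)
    ∨L   : ∀ {p q Γ Δ A B} → ⊢ (S p (A ∷ Γ ⇒ Δ) q) → ⊢ (S p (B ∷ Γ ⇒ Δ) q) →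
           ⊢ (S p (A ∨' B ∷ Γ ⇒ Δ) q)
    ∨R   : ∀ {p q Γ Δ A B} → ⊢ (S p (Γ ⇒ A ∷ B ∷ Δ) q) → ⊢ (S p (Γ ⇒ A ∨' B ∷ Δ) q)
    ∧L   : ∀ {p q Γ Δ A B} → ⊢ (S p (A ∷ B ∷ Γ ⇒ Δ) q) → ⊢ (S p (A ∧' B ∷ Γ ⇒ Δ) q)
    ∧R   : ∀ {p q Γ Δ A B} → ⊢ (S p (Γ ⇒ A ∷ Δ) q) → ⊢ (S p (Γ ⇒ B ∷ Δ) q) →
           ⊢ (S p (Γ ⇒ A ∧' B ∷ Δ) q)
    ⇒L   : ∀ {p q Γ Δ A B} → ⊢ (S p (B ∷ Γ ⇒ Δ) q) → ⊢ (S p (Γ ⇒ A ∷ Δ) q) →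
           ⊢ (S p (A ⇒' B ∷ Γ ⇒ Δ) q)
    ⇒R   : ∀ {p q Γ Δ A B} → ⊢ (S p (A ∷ Γ ⇒ B ∷ Δ) q) → ⊢ (S p (Γ ⇒ A ⇒' B ∷ Δ) q)
    wL   : ∀ {p q Γ Δ A} → ⊢ (S p (Γ ⇒ Δ) q) → ⊢ (S p (A ∷ Γ ⇒ Δ) q)
    wR   : ∀ {p q Γ Δ A} → ⊢ (S p (Γ ⇒ Δ) q) → ⊢ (S p (Γ ⇒ A ∷ Δ) q)
    cL   : ∀ {p q Γ Δ A} → ⊢ (S p (A ∷ A ∷ Γ ⇒ Δ) q) → ⊢ (S p (A ∷ Γ ⇒ Δ) q)
    cR   : ∀ {p q Γ Δ A} → ⊢ (S p (Γ ⇒ A ∷ A ∷ Δ) q) → ⊢ (S p (Γ ⇒ A ∷ Δ) q)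
    □L   : ∀ {p q Γ Δ Σ' Π A} i j → j ⪯ i →
           ⊢ (S₂ p (Γ ⇒ Δ) j (A ∷ Σ' ⇒ Π) q) →
           ⊢ (S₂ p (□ i A ∷ Γ ⇒ Δ) j (Σ' ⇒ Π) q)
    □R   : ∀ {p Γ Δ A} i →
           ⊢ (ctx p ((Γ ⇒ Δ) /[ i ] last ([] ⇒ A ∷ []))) →
           ⊢ (G p (Γ ⇒ □ i A ∷ Δ))
    d    : ∀ {p Γ Δ A} i j → j ⪯ i → KD⊆ 𝒟 j →
           ⊢ (ctx p ((Γ ⇒ Δ) /[ j ] last (A ∷ [] ⇒ []))) →
           ⊢ (G p (□ i A ∷ Γ ⇒ Δ))
    t    : ∀ {p q Γ Δ A} i → KT⊆ 𝒟 i →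
           ⊢ (S p (A ∷ Γ ⇒ Δ) q) → ⊢ (S p (□ i A ∷ Γ ⇒ Δ) q)
    4r   : ∀ {p q Γ Δ Σ' Π A} i j → j ⪯ i → K4⊆ 𝒟 i →
           ⊢ (S₂ p (Γ ⇒ Δ) j (□ i A ∷ Σ' ⇒ Π) q) →
           ⊢ (S₂ p (□ i A ∷ Γ ⇒ Δ) j (Σ' ⇒ Π) q)

-- Soundness. A linear nested sequent Γ₁ ⇒ Δ₁ /ᵢ Γ₂ ⇒ Δ₂ /ⱼ ⋯ is read as the formula
-- ⋀Γ₁ → ⋁Δ₁ ∨ □ᵢ(⋀Γ₂ → ⋁Δ₂ ∨ □ⱼ ⋯).  For every rule the implication from the readings of
-- the premisses to the reading of the conclusion is, at the components the rule touches, a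
-- tautological consequence of instances of K, D, T, 4 and of the inclusion axioms; necessitation
-- and K carry it through the unchanged prefix.
--
-- Completeness. Theorems of 𝓛 are first derived in a shallow one-component calculus whose
-- modal rules hand to their premiss the formulas that the boxes of the conclusion make
-- available in a k-successor: B for □ₘ B with k ⪯ m, and □ₘ B itself when m is K4.  This
-- calculus proves every tautology (countermodel from the atoms of a saturated sequent) and
-- admits cut, which gives modus ponens.  In the cut on a boxed formula □ᵢ A against a modal
-- premiss, A is replaced by the premisses of □ᵢ A and □ᵢ A by the boxes they came from;
-- transitive-closedness keeps those boxes K4, and the standing assumption lets the T rule
-- reach them.  A shallow derivation unfolds into an LNS derivation by opening a new last
-- component at each modal rule and moving the handed-over formulas in with (□ᵢⱼ)_L and 4ᵢⱼ.

module Submission where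

open import Defs
open import Data.Bool using (Bool; true; false; not; _∧_; _∨_; T)
open import Data.Bool.Properties using (T-∧; T-∨; T-≡; T?)
open import Data.Empty using (⊥; ⊥-elim)
open import Data.List using (List; []; _∷_; _++_; [_]; map)
import Data.List.Properties as List
open import Data.List.Membership.Propositional using (_∈_; find)
open import Data.List.Membership.Propositional.Properties using (∈-++⁻; ∈-∃++)
import Data.List.Membership.DecPropositional as DecMembership
import Data.List.Relation.Binary.Permutation.Propositional as ↭
open ↭ using (_↭_; ↭-sym)
open import Data.List.Relation.Binary.Permutation.Propositional.Properties
  using (All-resp-↭; Any-resp-↭; shift)
open import Data.List.Relation.Binary.Subset.Propositional using (_⊆_)
open import Data.List.Relation.Binary.Subset.Propositional.Properties
  using (⊆-refl; ⊆-trans; ⊆-reflexive-↭; ∷⁺ʳ; ∈-∷⁺ʳ; xs⊆xs++ys; xs⊆ys++xs; All-resp-⊇; Any-resp-⊆)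
open import Data.List.Relation.Unary.All using (All; []; _∷_)
import Data.List.Relation.Unary.All as All
import Data.List.Relation.Unary.All.Properties as All
open import Data.List.Relation.Unary.Any using (Any; here; there)
open import Data.Nat using (ℕ)
import Data.Nat.Properties as ℕ
open import Data.Product using (Σ; ∃; _×_; _,_; proj₁; proj₂)
import Data.Product as Product
open import Data.Product.Properties using (≡-dec)
open import Data.Sum using (_⊎_; inj₁; inj₂)
import Data.Sum as Sum
open import Data.Unit using (⊤; tt)
open import Function using (_∘_; id; const)
open import Function.Bundles using (_⇔_; mk⇔; Equivalence)
open Equivalence using (to; from)
open import Relation.Binary.Definitions using (DecidableEquality)
open import Relation.Binary.PropositionalEquality using (_≡_; refl; cong; cong₂; sym; trans; subst)
open import Relation.Binary.Structures using (IsPartialOrder)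
open import Relation.Nullary using (Dec; yes; no; ¬_)
open import Relation.Nullary.Decidable using (map′; _×-dec_; isYes; toWitness; fromWitness)

record Valuation (I : Set) : Set where
  constructor ⟨_,_⟩
  field
    atoms : ℕ → Bool
    boxes : I → Fm I → Bool
open Valuation

infix 4 _⊨_

record _⊨_ {I : Set} (ρ : Valuation I) (A : Fm I) : Set where
  constructor holds
  field truth : T (eval (atoms ρ) (boxes ρ) A)
open _⊨_

T-not : ∀ b → T (not b) ⇔ (¬ T b)
T-not true  = mk⇔ (λ ()) (λ f → f tt)
T-not false = mk⇔ (λ _ ()) (λ _ → tt)

T-→ : ∀ a b → T (not a ∨ b) ⇔ (T a → T b)
T-→ true  b = mk⇔ (λ tb _ → tb) (λ f → f tt)
T-→ false b = mk⇔ (λ _ ()) (λ _ → tt)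

module _ {I : Set} {ρ : Valuation I} where

  ⊨⊤ : ρ ⊨ ⊤'
  ⊨⊤ = holds tt

  ⊨¬ : ∀ {A} → ρ ⊨ ¬' A ⇔ (¬ ρ ⊨ A)
  ⊨¬ = mk⇔ (λ h a → to (T-not _) (truth h) (truth a))
           (λ f → holds (from (T-not _) (f ∘ holds)))

  ⊨∧ : ∀ {A B} → ρ ⊨ A ∧' B ⇔ (ρ ⊨ A × ρ ⊨ B)
  ⊨∧ = mk⇔ (Product.map holds holds ∘ to T-∧ ∘ truth)
           (holds ∘ from T-∧ ∘ Product.map truth truth)

  ⊨∨ : ∀ {A B} → ρ ⊨ A ∨' B ⇔ (ρ ⊨ A ⊎ ρ ⊨ B)
  ⊨∨ = mk⇔ (Sum.map holds holds ∘ to T-∨ ∘ truth)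
           (holds ∘ from T-∨ ∘ Sum.map truth truth)

  ⊨⇒ : ∀ {A B} → ρ ⊨ A ⇒' B ⇔ (ρ ⊨ A → ρ ⊨ B)
  ⊨⇒ = mk⇔ (λ h a → holds (to (T-→ _ _) (truth h) (truth a)))
           (λ f → holds (from (T-→ _ _) (truth ∘ f ∘ holds)))

  ⊨? : ∀ A → Dec (ρ ⊨ A)
  ⊨? A = map′ holds truth (T? _)

infixr 8 _⟹_

_⟹_ : {I : Set} → List (Fm I) → Fm I → Fm I
[]       ⟹ B = B
(A ∷ As) ⟹ B = A ⇒' (As ⟹ B)

conj : {I : Set} → List (Fm I) → Fm I
conj []      = ⊤'
conj (A ∷ Γ) = A ∧' conj Γ

disj : {I : Set} → List (Fm I) → Fm I → Fm I
disj []      Z = Z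
disj (A ∷ Δ) Z = A ∨' disj Δ Z

⌜_⌝ : {I : Set} → Seq I → Fm I → Fm I
⌜ Γ ⇒ Δ ⌝ Z = conj Γ ⇒' disj Δ Z

-- Z is the extra disjunct contributed by the part of a nested sequent below this component.
infix 0 _⊨ˢ_∣_

_⊨ˢ_∣_ : {I : Set} → Valuation I → Seq I → Fm I → Set
ρ ⊨ˢ Γ ⇒ Δ ∣ Z = All (ρ ⊨_) Γ → Any (ρ ⊨_) Δ ⊎ ρ ⊨ Z

module _ {I : Set} {ρ : Valuation I} where

  ⊨⟹ : ∀ {As B} → ρ ⊨ As ⟹ B ⇔ (All (ρ ⊨_) As → ρ ⊨ B)
  ⊨⟹ {[]}     = mk⇔ (λ b _ → b) (λ f → f [])
  ⊨⟹ {A ∷ As} = mk⇔ (λ where h (a ∷ as) → to ⊨⟹ (to ⊨⇒ h a) as)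
                    (λ f → from ⊨⇒ (λ a → from ⊨⟹ (λ as → f (a ∷ as))))

  ⊨conj : ∀ {Γ} → ρ ⊨ conj Γ ⇔ All (ρ ⊨_) Γ
  ⊨conj {[]}    = mk⇔ (λ _ → []) (λ _ → ⊨⊤)
  ⊨conj {A ∷ Γ} = mk⇔ (λ h → let a , c = to ⊨∧ h in a ∷ to ⊨conj c)
                      (λ where (a ∷ as) → from ⊨∧ (a , from ⊨conj as))

  ⊨disj : ∀ {Δ Z} → ρ ⊨ disj Δ Z ⇔ (Any (ρ ⊨_) Δ ⊎ ρ ⊨ Z)
  ⊨disj {[]}        = mk⇔ inj₂ (λ where (inj₂ z) → z; (inj₁ ()))
  ⊨disj {A ∷ Δ} {Z} = mk⇔ split join
    where
    split : ρ ⊨ disj (A ∷ Δ) Z → Any (ρ ⊨_) (A ∷ Δ) ⊎ ρ ⊨ Z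
    split h with to ⊨∨ h
    ... | inj₁ a = inj₁ (here a)
    ... | inj₂ r = Sum.map₁ there (to ⊨disj r)
    join : Any (ρ ⊨_) (A ∷ Δ) ⊎ ρ ⊨ Z → ρ ⊨ disj (A ∷ Δ) Z
    join (inj₁ (here a))  = from ⊨∨ (inj₁ a)
    join (inj₁ (there a)) = from ⊨∨ (inj₂ (from ⊨disj (inj₁ a)))
    join (inj₂ z)         = from ⊨∨ (inj₂ (from ⊨disj (inj₂ z)))

  ⊨⌜⌝ : ∀ {s Z} → ρ ⊨ ⌜ s ⌝ Z ⇔ (ρ ⊨ˢ s ∣ Z)
  ⊨⌜⌝ = mk⇔ (λ h as → to ⊨disj (to ⊨⇒ h (from ⊨conj as)))
            (λ f → from ⊨⇒ (from ⊨disj ∘ f ∘ to ⊨conj))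

module _ {I : Set} {ρ : Valuation I} {Z : Fm I} where

  private
    hit : ∀ {A Δ} → ρ ⊨ A → Any (ρ ⊨_) (A ∷ Δ) ⊎ ρ ⊨ Z
    hit = inj₁ ∘ here

    skip : ∀ {A Δ} → Any (ρ ⊨_) Δ ⊎ ρ ⊨ Z → Any (ρ ⊨_) (A ∷ Δ) ⊎ ρ ⊨ Z
    skip = Sum.map₁ there

    uncons : ∀ {A Δ} → Any (ρ ⊨_) (A ∷ Δ) ⊎ ρ ⊨ Z → ρ ⊨ A ⊎ (Any (ρ ⊨_) Δ ⊎ ρ ⊨ Z)
    uncons (inj₁ (here a))  = inj₁ a
    uncons (inj₁ (there x)) = inj₂ (inj₁ x)
    uncons (inj₂ z)         = inj₂ (inj₂ z)

  private variable
    Γ Γ′ Δ Δ′ : List (Fm I)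

  ⊨ˢ-ex : Γ ↭ Γ′ → Δ ↭ Δ′ → (ρ ⊨ˢ Γ ⇒ Δ ∣ Z) → (ρ ⊨ˢ Γ′ ⇒ Δ′ ∣ Z)
  ⊨ˢ-ex πΓ πΔ h = Sum.map₁ (Any-resp-↭ πΔ) ∘ h ∘ All-resp-↭ (↭-sym πΓ)

  ⊨ˢ-init : ∀ {n} → ρ ⊨ˢ var n ∷ Γ ⇒ var n ∷ Δ ∣ Z
  ⊨ˢ-init (a ∷ _) = hit a

  ⊨ˢ-⊥L : ρ ⊨ˢ ⊥' ∷ Γ ⇒ Δ ∣ Z
  ⊨ˢ-⊥L (() ∷ _)

  ⊨ˢ-⊤R : ρ ⊨ˢ Γ ⇒ ⊤' ∷ Δ ∣ Z
  ⊨ˢ-⊤R _ = hit ⊨⊤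

  ⊨ˢ-¬L : ∀ {A} → (ρ ⊨ˢ Γ ⇒ A ∷ Δ ∣ Z) → (ρ ⊨ˢ ¬' A ∷ Γ ⇒ Δ ∣ Z)
  ⊨ˢ-¬L h (n ∷ as) = Sum.[ ⊥-elim ∘ to ⊨¬ n , id ] (uncons (h as))

  ⊨ˢ-¬R : ∀ {A} → (ρ ⊨ˢ A ∷ Γ ⇒ Δ ∣ Z) → (ρ ⊨ˢ Γ ⇒ ¬' A ∷ Δ ∣ Z)
  ⊨ˢ-¬R {A = A} h as with ⊨? A
  ... | yes a = skip (h (a ∷ as))
  ... | no na = hit (from ⊨¬ na)

  ⊨ˢ-∧L : ∀ {A B} → (ρ ⊨ˢ A ∷ B ∷ Γ ⇒ Δ ∣ Z) → (ρ ⊨ˢ A ∧' B ∷ Γ ⇒ Δ ∣ Z)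
  ⊨ˢ-∧L h (c ∷ as) = let a , b = to ⊨∧ c in h (a ∷ b ∷ as)

  ⊨ˢ-∧R : ∀ {A B} → (ρ ⊨ˢ Γ ⇒ A ∷ Δ ∣ Z) → (ρ ⊨ˢ Γ ⇒ B ∷ Δ ∣ Z) →
          (ρ ⊨ˢ Γ ⇒ A ∧' B ∷ Δ ∣ Z)
  ⊨ˢ-∧R h₁ h₂ as with uncons (h₁ as) | uncons (h₂ as)
  ... | inj₁ a | inj₁ b = hit (from ⊨∧ (a , b))
  ... | inj₂ r | _      = skip r
  ... | inj₁ _ | inj₂ r = skip r

  ⊨ˢ-∨L : ∀ {A B} → (ρ ⊨ˢ A ∷ Γ ⇒ Δ ∣ Z) → (ρ ⊨ˢ B ∷ Γ ⇒ Δ ∣ Z) →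
          (ρ ⊨ˢ A ∨' B ∷ Γ ⇒ Δ ∣ Z)
  ⊨ˢ-∨L h₁ h₂ (ab ∷ as) = Sum.[ h₁ ∘ (_∷ as) , h₂ ∘ (_∷ as) ] (to ⊨∨ ab)

  ⊨ˢ-∨R : ∀ {A B} → (ρ ⊨ˢ Γ ⇒ A ∷ B ∷ Δ ∣ Z) → (ρ ⊨ˢ Γ ⇒ A ∨' B ∷ Δ ∣ Z)
  ⊨ˢ-∨R h as with uncons (h as)
  ... | inj₁ a = hit (from ⊨∨ (inj₁ a))
  ... | inj₂ r with uncons r
  ...   | inj₁ b  = hit (from ⊨∨ (inj₂ b))
  ...   | inj₂ r′ = skip r′

  ⊨ˢ-⇒L : ∀ {A B} → (ρ ⊨ˢ B ∷ Γ ⇒ Δ ∣ Z) → (ρ ⊨ˢ Γ ⇒ A ∷ Δ ∣ Z) →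
          (ρ ⊨ˢ A ⇒' B ∷ Γ ⇒ Δ ∣ Z)
  ⊨ˢ-⇒L h₁ h₂ (f ∷ as) = Sum.[ (λ a → h₁ (to ⊨⇒ f a ∷ as)) , id ] (uncons (h₂ as))

  ⊨ˢ-⇒R : ∀ {A B} → (ρ ⊨ˢ A ∷ Γ ⇒ B ∷ Δ ∣ Z) → (ρ ⊨ˢ Γ ⇒ A ⇒' B ∷ Δ ∣ Z)
  ⊨ˢ-⇒R {A = A} h as with ⊨? A
  ... | no na = hit (from ⊨⇒ (⊥-elim ∘ na))
  ... | yes a with uncons (h (a ∷ as))
  ...   | inj₁ b = hit (from ⊨⇒ (const b))
  ...   | inj₂ r = skip r

  ⊨ˢ-wL : ∀ {A} → (ρ ⊨ˢ Γ ⇒ Δ ∣ Z) → (ρ ⊨ˢ A ∷ Γ ⇒ Δ ∣ Z)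
  ⊨ˢ-wL h (_ ∷ as) = h as

  ⊨ˢ-wR : ∀ {A} → (ρ ⊨ˢ Γ ⇒ Δ ∣ Z) → (ρ ⊨ˢ Γ ⇒ A ∷ Δ ∣ Z)
  ⊨ˢ-wR h = skip ∘ h

  ⊨ˢ-cL : ∀ {A} → (ρ ⊨ˢ A ∷ A ∷ Γ ⇒ Δ ∣ Z) → (ρ ⊨ˢ A ∷ Γ ⇒ Δ ∣ Z)
  ⊨ˢ-cL h (a ∷ as) = h (a ∷ a ∷ as)

  ⊨ˢ-cR : ∀ {A} → (ρ ⊨ˢ Γ ⇒ A ∷ A ∷ Δ ∣ Z) → (ρ ⊨ˢ Γ ⇒ A ∷ Δ ∣ Z)
  ⊨ˢ-cR h as = Sum.[ hit , id ] (uncons (h as))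

module _ {I : Set} {ρ : Valuation I} {Γ Δ : List (Fm I)} {Z Z′ : Fm I} where

  ⊨ˢ-residueL : ∀ {C} → (ρ ⊨ C → ρ ⊨ Z → ρ ⊨ Z′) →
                (ρ ⊨ˢ Γ ⇒ Δ ∣ Z) → (ρ ⊨ˢ C ∷ Γ ⇒ Δ ∣ Z′)
  ⊨ˢ-residueL f h (c ∷ as) = Sum.map₂ (f c) (h as)

  ⊨ˢ-residueR : ∀ {C} → (ρ ⊨ Z → ρ ⊨ C) → (ρ ⊨ˢ Γ ⇒ Δ ∣ Z) → (ρ ⊨ˢ Γ ⇒ C ∷ Δ ∣ Z′)
  ⊨ˢ-residueR f h as = Sum.[ inj₁ ∘ there , inj₁ ∘ here ∘ f ] (h as)

module _ {I : Set} {ρ : Valuation I} {A : Fm I} where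

  ⌜⇒A⌝-elim : ρ ⊨ ⌜ [] ⇒ A ∷ [] ⌝ ⊥' → ρ ⊨ A
  ⌜⇒A⌝-elim h with to (⊨⌜⌝ {s = [] ⇒ A ∷ []}) h []
  ... | inj₁ (here a) = a

  ⌜A⇒⌝-elim : ρ ⊨ A → ¬ ρ ⊨ ⌜ A ∷ [] ⇒ [] ⌝ ⊥'
  ⌜A⇒⌝-elim a h with to (⊨⌜⌝ {s = A ∷ [] ⇒ []}) h (a ∷ [])
  ... | inj₂ ()

All-⊎ : ∀ {X E : Set} {P : X → Set} {xs} → All (λ x → E ⊎ P x) xs → E ⊎ All P xs
All-⊎ []              = inj₂ []
All-⊎ (inj₁ e ∷ _)    = inj₁ e
All-⊎ (inj₂ p ∷ rest) = Sum.map₂ (p ∷_) (All-⊎ rest)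

⊨⌜⌝-⟹ : ∀ {I} {ρ : Valuation I} {X : Set} s (f : X → Fm I) xs {Z} →
        ρ ⊨ map f xs ⟹ Z → ρ ⊨ map (⌜ s ⌝ ∘ f) xs ⟹ ⌜ s ⌝ Z
⊨⌜⌝-⟹ s f xs h = from (⊨⟹ {As = map (⌜ s ⌝ ∘ f) xs}) λ hs → from (⊨⌜⌝ {s = s}) λ as →
  Sum.map₂ (to (⊨⟹ {As = map f xs}) h ∘ All.map⁺)
           (All-⊎ (All.map (λ h′ → to (⊨⌜⌝ {s = s}) h′ as) (All.map⁻ hs)))

LocallyValid : {I : Set} → List (Fm I) → List (Seq I) → Seq I → Set
LocallyValid {I} Es Xs Y =
  ∀ {ρ : Valuation I} {Z} → All (ρ ⊨_) Es → All (λ X → ρ ⊨ˢ X ∣ Z) Xs → ρ ⊨ˢ Y ∣ Z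

⊨-LocallyValid : ∀ {I} {ρ : Valuation I} {Z} Es Xs Y → LocallyValid Es Xs Y →
                 ρ ⊨ Es ⟹ map (λ X → ⌜ X ⌝ Z) Xs ⟹ ⌜ Y ⌝ Z
⊨-LocallyValid {Z = Z} Es Xs Y valid =
  from (⊨⟹ {As = Es}) λ es → from (⊨⟹ {As = map (λ X → ⌜ X ⌝ Z) Xs}) λ xs →
  from (⊨⌜⌝ {s = Y}) (valid es (All.map (λ {X} → to (⊨⌜⌝ {s = X})) (All.map⁻ xs)))

module _ {I : Set} {_≤_ : I → I → Set} {F : I → AxSet} where

  private
    Thm : Fm I → Set
    Thm = HThm _≤_ F

  mp⋆ : ∀ {As B} → Thm (As ⟹ B) → All Thm As → Thm B
  mp⋆ h []       = h
  mp⋆ h (a ∷ as) = mp⋆ (mp h a) as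

  tautological : ∀ {As B} → (∀ (ρ : Valuation I) → All (ρ ⊨_) As → ρ ⊨ B) → All Thm As → Thm B
  tautological h = mp⋆ (taut λ v w → to T-≡ (truth (from ⊨⟹ (h ⟨ v , w ⟩))))

  K⋆ : ∀ {X : Set} i (f : X → Fm I) xs {B} →
       Thm (□ i (map f xs ⟹ B) ⇒' (map (□ i ∘ f) xs ⟹ □ i B))
  K⋆ i f []       = tautological (λ _ _ → from ⊨⇒ id) []
  K⋆ i f (x ∷ xs) = tautological
    (λ where _ (k ∷ k⋆ ∷ []) → from ⊨⇒ λ h → from ⊨⇒ λ a → to ⊨⇒ k⋆ (to ⊨⇒ (to ⊨⇒ k h) a))
    (axK i (f x) _ ∷ K⋆ i f xs ∷ [])

  nec⋆ : ∀ {X : Set} i (f : X → Fm I) xs {B} →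
         Thm (map f xs ⟹ B) → Thm (map (□ i ∘ f) xs ⟹ □ i B)
  nec⋆ i f xs h = mp (K⋆ i f xs) (nec i h)

  _[_]at_ : Fm ⊤ → (ℕ → Fm I) → I → Fm I
  var n    [ σ ]at i = σ n
  ⊥'       [ σ ]at i = ⊥'
  ⊤'       [ σ ]at i = ⊤'
  (¬' A)   [ σ ]at i = ¬' (A [ σ ]at i)
  (A ∧' B) [ σ ]at i = A [ σ ]at i ∧' B [ σ ]at i
  (A ∨' B) [ σ ]at i = A [ σ ]at i ∨' B [ σ ]at i
  (A ⇒' B) [ σ ]at i = A [ σ ]at i ⇒' B [ σ ]at i
  □ _ A    [ σ ]at i = □ i (A [ σ ]at i)

  eval-at : ∀ σ i v w A →
            eval v w (A [ σ ]at i) ≡ eval (eval v w ∘ σ) (λ _ B → w i (B [ σ ]at i)) A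
  eval-at σ i v w (var n)  = refl
  eval-at σ i v w ⊥'       = refl
  eval-at σ i v w ⊤'       = refl
  eval-at σ i v w (¬' A)   = cong not (eval-at σ i v w A)
  eval-at σ i v w (A ∧' B) = cong₂ _∧_ (eval-at σ i v w A) (eval-at σ i v w B)
  eval-at σ i v w (A ∨' B) = cong₂ _∨_ (eval-at σ i v w A) (eval-at σ i v w B)
  eval-at σ i v w (A ⇒' B) = cong₂ (λ a b → not a ∨ b) (eval-at σ i v w A) (eval-at σ i v w B)
  eval-at σ i v w (□ _ A)  = refl

  MonoThm-at : ∀ {i} σ {A} → MonoThm (F i) A → Thm (A [ σ ]at i)
  MonoThm-at {i} σ {A} (taut ⊨A) = taut (λ v w → trans (eval-at σ i v w A) (⊨A _ _))
  MonoThm-at σ (axK _ A B)       = axK _ _ _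
  MonoThm-at σ (axD _ e)         = axD _ e
  MonoThm-at σ (axT _ A e)       = axT _ _ e
  MonoThm-at σ (ax4 _ A e)       = ax4 _ _ e
  MonoThm-at σ (incl _ _ _ ())
  MonoThm-at σ (mp h h′)         = mp (MonoThm-at σ h) (MonoThm-at σ h′)
  MonoThm-at σ (nec _ h)         = nec _ (MonoThm-at σ h)

⊆ᴸ-by-flags : ∀ {ax ax′} → (hasD ax ≡ true → hasD ax′ ≡ true) → (hasT ax ≡ true → hasT ax′ ≡ true) →
              (has4 ax ≡ true → has4 ax′ ≡ true) → ax ⊆ᴸ ax′
⊆ᴸ-by-flags fD fT f4 _ (taut ⊨A)    = taut ⊨A
⊆ᴸ-by-flags fD fT f4 _ (axK i A B)  = axK i A B
⊆ᴸ-by-flags fD fT f4 _ (axD i e)    = axD i (fD e)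
⊆ᴸ-by-flags fD fT f4 _ (axT i A e)  = axT i A (fT e)
⊆ᴸ-by-flags fD fT f4 _ (ax4 i A e)  = ax4 i A (f4 e)
⊆ᴸ-by-flags fD fT f4 _ (incl _ _ _ ())
⊆ᴸ-by-flags fD fT f4 _ (mp h h′)    = mp (⊆ᴸ-by-flags fD fT f4 _ h) (⊆ᴸ-by-flags fD fT f4 _ h′)
⊆ᴸ-by-flags fD fT f4 _ (nec i h)    = nec i (⊆ᴸ-by-flags fD fT f4 _ h)

-- Soundness of the linear nested sequent calculus

module Soundness (𝒟 : Description) where
  open Description 𝒟

  private
    Fo = Fm Idx
    Thm = 𝓛 𝒟

  ι : LNS Idx → Fo
  ι (last s)      = ⌜ s ⌝ ⊥'
  ι (s /[ i ] r) = ⌜ s ⌝ (□ i (ι r))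

  ctx-⟹ : ∀ {X : Set} p (f : X → LNS Idx) xs {r} →
          Thm (map (ι ∘ f) xs ⟹ ι r) → Thm (map (ι ∘ ctx p ∘ f) xs ⟹ ι (ctx p r))
  ctx-⟹ []             f xs h = h
  ctx-⟹ ((s , i) ∷ p) f xs h =
    tautological (λ where _ (h′ ∷ []) → ⊨⌜⌝-⟹ s _ xs h′)
                 (nec⋆ i (ι ∘ ctx p ∘ f) xs (ctx-⟹ p f xs h) ∷ [])

  -- The clauses are identical: splitting q only lets ι (X ⊕ q) reduce to some ⌜ X ⌝ Z.
  local-⟹ : ∀ q Es Xs Y → LocallyValid Es Xs Y → Thm (Es ⟹ map (λ X → ι (X ⊕ q)) Xs ⟹ ι (Y ⊕ q))
  local-⟹ []      Es Xs Y valid = tautological (λ _ _ → ⊨-LocallyValid Es Xs Y valid) []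
  local-⟹ (_ ∷ _) Es Xs Y valid = tautological (λ _ _ → ⊨-LocallyValid Es Xs Y valid) []

  local-sound : ∀ p q {Es} Xs Y → All Thm Es → LocallyValid Es Xs Y →
                All Thm (map (λ X → ι (S p X q)) Xs) → Thm (ι (S p Y q))
  local-sound p q {Es} Xs Y es valid = mp⋆ (ctx-⟹ p (_⊕ q) Xs (mp⋆ (local-⟹ q Es Xs Y valid) es))

  local-sound₀ : ∀ p q {Y} → (∀ {ρ Z} → ρ ⊨ˢ Y ∣ Z) → Thm (ι (S p Y q))
  local-sound₀ p q valid = local-sound p q [] _ [] (λ _ _ → valid) []

  local-sound₁ : ∀ p q {X Y} → (∀ {ρ Z} → ρ ⊨ˢ X ∣ Z → ρ ⊨ˢ Y ∣ Z) →
                 Thm (ι (S p X q)) → Thm (ι (S p Y q))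
  local-sound₁ p q valid D = local-sound p q (_ ∷ []) _ [] (λ where _ (h ∷ []) → valid h) (D ∷ [])

  local-sound₂ : ∀ p q {X₁ X₂ Y} → (∀ {ρ Z} → ρ ⊨ˢ X₁ ∣ Z → ρ ⊨ˢ X₂ ∣ Z → ρ ⊨ˢ Y ∣ Z) →
                 Thm (ι (S p X₁ q)) → Thm (ι (S p X₂ q)) → Thm (ι (S p Y q))
  local-sound₂ p q valid D₁ D₂ =
    local-sound p q (_ ∷ _ ∷ []) _ [] (λ where _ (h₁ ∷ h₂ ∷ []) → valid h₁ h₂) (D₁ ∷ D₂ ∷ [])

  T-fact : ∀ {i} → KT⊆ 𝒟 i → ∀ A → Thm (□ i A ⇒' A)
  T-fact kt A = MonoThm-at (const A) (kt _ (axT tt (var 0) refl))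

  D-fact : ∀ {i} → KD⊆ 𝒟 i → Thm (¬' □ i ⊥')
  D-fact kd = MonoThm-at (const ⊥') (kd _ (axD tt refl))

  4-fact : ∀ {i} → K4⊆ 𝒟 i → ∀ A → Thm (□ i A ⇒' □ i (□ i A))
  4-fact k4 A = MonoThm-at (const A) (k4 _ (ax4 tt (var 0) refl))

  □L-sound : ∀ p q {Γ Δ Σ Π A B} i j → Thm (□ i A ⇒' □ j B) →
             Thm (ι (S₂ p (Γ ⇒ Δ) j (B ∷ Σ ⇒ Π) q)) → Thm (ι (S₂ p (□ i A ∷ Γ ⇒ Δ) j (Σ ⇒ Π) q))
  □L-sound p q {Γ} {Δ} {Σ} {Π} {A} {B} i j □ᵢA⇒□ⱼB =
    mp (ctx-⟹ p id ((Γ ⇒ Δ) /[ j ] ((B ∷ Σ ⇒ Π) ⊕ q) ∷ []) (tautological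
         (λ where _ (f ∷ k ∷ []) → from ⊨⇒ λ h → from ⊨⌜⌝
                    (⊨ˢ-residueL (λ a x → to ⊨⇒ (to ⊨⇒ k (to ⊨⇒ f a)) x) (to ⊨⌜⌝ h)))
         (□ᵢA⇒□ⱼB ∷ nec⋆ j id (B ∷ ι ((B ∷ Σ ⇒ Π) ⊕ q) ∷ []) B-used ∷ [])))
    where
    B-used : Thm (B ⇒' ι ((B ∷ Σ ⇒ Π) ⊕ q) ⇒' ι ((Σ ⇒ Π) ⊕ q))
    B-used = local-⟹ q (B ∷ []) ((B ∷ Σ ⇒ Π) ∷ []) (Σ ⇒ Π) λ where (b ∷ []) (h ∷ []) as → h (b ∷ as)

  d-sound : ∀ p {Γ Δ A} i j → Thm (□ i A ⇒' □ j A) → Thm (¬' □ j ⊥') →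
            Thm (ι (ctx p ((Γ ⇒ Δ) /[ j ] last (A ∷ [] ⇒ [])))) → Thm (ι (G p (□ i A ∷ Γ ⇒ Δ)))
  d-sound p {Γ} {Δ} {A} i j □ᵢA⇒□ⱼA ¬□ⱼ⊥ =
    mp (ctx-⟹ p id ((Γ ⇒ Δ) /[ j ] last (A ∷ [] ⇒ []) ∷ []) (tautological
         (λ where _ (f ∷ k ∷ n ∷ []) → from ⊨⇒ λ h → from ⊨⌜⌝ (⊨ˢ-residueL
                    (λ a x → ⊥-elim (to ⊨¬ n (to ⊨⇒ (to ⊨⇒ k (to ⊨⇒ f a)) x))) (to ⊨⌜⌝ h)))
         (□ᵢA⇒□ⱼA ∷ nec⋆ j id (A ∷ ι (last (A ∷ [] ⇒ [])) ∷ []) inconsistent ∷ ¬□ⱼ⊥ ∷ [])))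
    where
    inconsistent : Thm (A ⇒' ι (last (A ∷ [] ⇒ [])) ⇒' ⊥')
    inconsistent = tautological (λ _ _ → from ⊨⇒ λ a → from ⊨⇒ (⊥-elim ∘ ⌜A⇒⌝-elim a)) []

  □R-sound : ∀ p {Γ Δ A} i →
             Thm (ι (ctx p ((Γ ⇒ Δ) /[ i ] last ([] ⇒ A ∷ [])))) → Thm (ι (G p (Γ ⇒ □ i A ∷ Δ)))
  □R-sound p {Γ} {Δ} {A} i =
    mp (ctx-⟹ p id ((Γ ⇒ Δ) /[ i ] last ([] ⇒ A ∷ []) ∷ []) (tautological
         (λ where _ (k ∷ []) → from ⊨⇒ λ h → from ⊨⌜⌝ (⊨ˢ-residueR (to ⊨⇒ k) (to ⊨⌜⌝ h)))
         (nec⋆ i id (ι (last ([] ⇒ A ∷ [])) ∷ []) A-only ∷ [])))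
    where
    A-only : Thm (ι (last ([] ⇒ A ∷ [])) ⇒' A)
    A-only = tautological (λ _ _ → from ⊨⇒ ⌜⇒A⌝-elim) []

  sound : ∀ {𝒩} → ⊢ 𝒟 𝒩 → Thm (ι 𝒩)
  sound (ex {p} {q} πΓ πΔ D)  = local-sound₁ p q (⊨ˢ-ex πΓ πΔ) (sound D)
  sound (init {p} {q} n)      = local-sound₀ p q ⊨ˢ-init
  sound (⊥L {p} {q})          = local-sound₀ p q ⊨ˢ-⊥L
  sound (⊤R {p} {q})          = local-sound₀ p q ⊨ˢ-⊤R
  sound (¬L {p} {q} D)        = local-sound₁ p q ⊨ˢ-¬L (sound D)
  sound (¬R {p} {q} D)        = local-sound₁ p q ⊨ˢ-¬R (sound D)
  sound (∨L {p} {q} D₁ D₂)    = local-sound₂ p q ⊨ˢ-∨L (sound D₁) (sound D₂)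
  sound (∨R {p} {q} D)        = local-sound₁ p q ⊨ˢ-∨R (sound D)
  sound (∧L {p} {q} D)        = local-sound₁ p q ⊨ˢ-∧L (sound D)
  sound (∧R {p} {q} D₁ D₂)    = local-sound₂ p q ⊨ˢ-∧R (sound D₁) (sound D₂)
  sound (⇒L {p} {q} D₁ D₂)    = local-sound₂ p q ⊨ˢ-⇒L (sound D₁) (sound D₂)
  sound (⇒R {p} {q} D)        = local-sound₁ p q ⊨ˢ-⇒R (sound D)
  sound (wL {p} {q} D)        = local-sound₁ p q ⊨ˢ-wL (sound D)
  sound (wR {p} {q} D)        = local-sound₁ p q ⊨ˢ-wR (sound D)
  sound (cL {p} {q} D)        = local-sound₁ p q ⊨ˢ-cL (sound D)
  sound (cR {p} {q} D)        = local-sound₁ p q ⊨ˢ-cR (sound D)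
  sound (t {p} {q} {A = A} i kt D) =
    local-sound p q (_ ∷ []) _ (T-fact kt A ∷ [])
      (λ where (f ∷ []) (h ∷ []) (c ∷ as) → h (to ⊨⇒ f c ∷ as)) (sound D ∷ [])
  sound (□L {p} {q} {A = A} i j j⪯i D)    = □L-sound p q i j (incl j i A j⪯i) (sound D)
  sound (4r {p} {q} {A = A} i j j⪯i k4 D) =
    □L-sound p q i j (tautological (λ where _ (f ∷ g ∷ []) → from ⊨⇒ (to ⊨⇒ g ∘ to ⊨⇒ f))
                                   (4-fact k4 A ∷ incl j i (□ i A) j⪯i ∷ []))
             (sound D)
  sound (d {p} {A = A} i j j⪯i kd D) = d-sound p i j (incl j i A j⪯i) (D-fact kd) (sound D)
  sound (□R {p} i D)                  = □R-sound p i (sound D)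

  ⊢⇒𝓛 : ∀ {A} → ⊢ 𝒟 (last ([] ⇒ A ∷ [])) → Thm A
  ⊢⇒𝓛 D = tautological (λ where _ (h ∷ []) → ⌜⇒A⌝-elim h) (sound D ∷ [])

-- The shallow calculus

module ShallowCalculus (𝒟 : Description) where
  open Description 𝒟 public

  Fo : Set
  Fo = Fm Idx

  variable
    A B C : Fo
    Γ Γ′ Δ Δ′ Θ Ξ : List Fo
    i j k l : Idx
    n : ℕ

  ⪯-refl : i ⪯ i
  ⪯-refl = IsPartialOrder.reflexive ⪯-po refl

  ⪯-trans : i ⪯ j → j ⪯ k → i ⪯ k
  ⪯-trans = IsPartialOrder.trans ⪯-po

  data Inherited (k : Idx) (Γ : List Fo) : Fo → Set where
    unbox : □ i A ∈ Γ → k ⪯ i → Inherited k Γ A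
    keep4 : □ i A ∈ Γ → k ⪯ i → K4⊆ 𝒟 i → Inherited k Γ (□ i A)

  Inherits : Idx → List Fo → List Fo → Set
  Inherits k Γ = All (Inherited k Γ)

  -- Principal formulas stay in the conclusion, so contraction is built in.  The modal rules
  -- are those of LNS applied to a fresh last component followed by moving the inherited Θ in.
  infix 1 _⊢ₛ_

  data _⊢ₛ_ : List Fo → List Fo → Set where
    init : var n ∈ Γ → var n ∈ Δ → Γ ⊢ₛ Δ
    ⊥L   : ⊥' ∈ Γ → Γ ⊢ₛ Δ
    ⊤R   : ⊤' ∈ Δ → Γ ⊢ₛ Δ
    ¬L   : ¬' A ∈ Γ → Γ ⊢ₛ A ∷ Δ → Γ ⊢ₛ Δ
    ¬R   : ¬' A ∈ Δ → A ∷ Γ ⊢ₛ Δ → Γ ⊢ₛ Δ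
    ∧L   : A ∧' B ∈ Γ → A ∷ B ∷ Γ ⊢ₛ Δ → Γ ⊢ₛ Δ
    ∧R   : A ∧' B ∈ Δ → Γ ⊢ₛ A ∷ Δ → Γ ⊢ₛ B ∷ Δ → Γ ⊢ₛ Δ
    ∨L   : A ∨' B ∈ Γ → A ∷ Γ ⊢ₛ Δ → B ∷ Γ ⊢ₛ Δ → Γ ⊢ₛ Δ
    ∨R   : A ∨' B ∈ Δ → Γ ⊢ₛ A ∷ B ∷ Δ → Γ ⊢ₛ Δ
    ⇒L   : A ⇒' B ∈ Γ → B ∷ Γ ⊢ₛ Δ → Γ ⊢ₛ A ∷ Δ → Γ ⊢ₛ Δ
    ⇒R   : A ⇒' B ∈ Δ → A ∷ Γ ⊢ₛ B ∷ Δ → Γ ⊢ₛ Δ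
    □R   : □ k A ∈ Δ → Inherits k Γ Θ → Θ ⊢ₛ [ A ] → Γ ⊢ₛ Δ
    d    : □ l A ∈ Γ → j ⪯ l → KD⊆ 𝒟 j → Inherits j Γ Θ → Θ ++ [ A ] ⊢ₛ [] → Γ ⊢ₛ Δ
    t    : □ i A ∈ Γ → KT⊆ 𝒟 i → A ∷ Γ ⊢ₛ Δ → Γ ⊢ₛ Δ

  Inherited-mono : Γ ⊆ Γ′ → Inherited k Γ A → Inherited k Γ′ A
  Inherited-mono γ (unbox p k⪯i)    = unbox (γ p) k⪯i
  Inherited-mono γ (keep4 p k⪯i k4) = keep4 (γ p) k⪯i k4

  Inherits-mono : Γ ⊆ Γ′ → Inherits k Γ Θ → Inherits k Γ′ Θ
  Inherits-mono γ = All.map (Inherited-mono γ)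

  wk : Γ ⊆ Γ′ → Δ ⊆ Δ′ → Γ ⊢ₛ Δ → Γ′ ⊢ₛ Δ′
  wk γ δ (init p q)        = init (γ p) (δ q)
  wk γ δ (⊥L p)            = ⊥L (γ p)
  wk γ δ (⊤R q)            = ⊤R (δ q)
  wk γ δ (¬L p D)          = ¬L (γ p) (wk γ (∷⁺ʳ _ δ) D)
  wk γ δ (¬R q D)          = ¬R (δ q) (wk (∷⁺ʳ _ γ) δ D)
  wk γ δ (∧L p D)          = ∧L (γ p) (wk (∷⁺ʳ _ (∷⁺ʳ _ γ)) δ D)
  wk γ δ (∧R q D₁ D₂)      = ∧R (δ q) (wk γ (∷⁺ʳ _ δ) D₁) (wk γ (∷⁺ʳ _ δ) D₂)
  wk γ δ (∨L p D₁ D₂)      = ∨L (γ p) (wk (∷⁺ʳ _ γ) δ D₁) (wk (∷⁺ʳ _ γ) δ D₂)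
  wk γ δ (∨R q D)          = ∨R (δ q) (wk γ (∷⁺ʳ _ (∷⁺ʳ _ δ)) D)
  wk γ δ (⇒L p D₁ D₂)      = ⇒L (γ p) (wk (∷⁺ʳ _ γ) δ D₁) (wk γ (∷⁺ʳ _ δ) D₂)
  wk γ δ (⇒R q D)          = ⇒R (δ q) (wk (∷⁺ʳ _ γ) (∷⁺ʳ _ δ) D)
  wk γ δ (□R q js D)       = □R (δ q) (Inherits-mono γ js) D
  wk γ δ (d p j⪯l kd js D) = d (γ p) j⪯l kd (Inherits-mono γ js) D
  wk γ δ (t p kt D)        = t (γ p) kt (wk (∷⁺ʳ _ γ) δ D)

  ⊢ₛ-id : ∀ A → A ∈ Γ → A ∈ Δ → Γ ⊢ₛ Δ
  ⊢ₛ-id (var n)  p q = init p q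
  ⊢ₛ-id ⊥'       p q = ⊥L p
  ⊢ₛ-id ⊤'       p q = ⊤R q
  ⊢ₛ-id (¬' A)   p q = ¬R q (¬L (there p) (⊢ₛ-id A (here refl) (here refl)))
  ⊢ₛ-id (A ∧' B) p q = ∧L p (∧R q (⊢ₛ-id A (here refl) (here refl))
                                  (⊢ₛ-id B (there (here refl)) (here refl)))
  ⊢ₛ-id (A ∨' B) p q = ∨R q (∨L p (⊢ₛ-id A (here refl) (here refl))
                                  (⊢ₛ-id B (here refl) (there (here refl))))
  ⊢ₛ-id (A ⇒' B) p q = ⇒R q (⇒L (there p) (⊢ₛ-id B (here refl) (here refl))
                                          (⊢ₛ-id A (here refl) (here refl)))
  ⊢ₛ-id (□ i A)  p q = □R q (unbox p ⪯-refl ∷ []) (⊢ₛ-id A (here refl) (here refl))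

  ModalPremiss : Idx → List Fo → List Fo → Set
  ModalPremiss k Γ Π = Σ (List Fo) λ Θ → Inherits k Γ Θ × (Θ ⊢ₛ Π)

-- Cut admissibility for the shallow calculus

module _ {X : Set} {x : X} where

  shift-⊆ : ∀ xs {ys} → xs ++ x ∷ ys ⊆ x ∷ xs ++ ys
  shift-⊆ xs = ⊆-reflexive-↭ (shift x xs _)

  shift-⊇ : ∀ xs {ys} → x ∷ xs ++ ys ⊆ xs ++ x ∷ ys
  shift-⊇ xs = ⊆-reflexive-↭ (↭-sym (shift x xs _))

  ⊆-under : ∀ {xs ys} zs → xs ⊆ x ∷ ys → xs ⊆ x ∷ zs ++ ys
  ⊆-under zs s p with s p
  ... | here e   = here e
  ... | there p′ = there (xs⊆ys++xs _ zs p′)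

  ++-⊆-under : ∀ {xs ys} zs → xs ⊆ x ∷ ys → zs ++ xs ⊆ x ∷ zs ++ ys
  ++-⊆-under zs s p with ∈-++⁻ zs p
  ... | inj₁ p′ = there (xs⊆xs++ys zs _ p′)
  ... | inj₂ p′ = ⊆-under zs s p′

module CutAdmissibility (𝒟 : Description) (tc : TransitiveClosed 𝒟) (sa : StandingAssumption 𝒟) where
  open ShallowCalculus 𝒟

  Inherited-lower : k ⪯ i → Inherited i Γ A → Inherited k Γ A
  Inherited-lower k⪯i (unbox p i⪯m)    = unbox p (⪯-trans k⪯i i⪯m)
  Inherited-lower k⪯i (keep4 p i⪯m k4) = keep4 p (⪯-trans k⪯i i⪯m) k4

  -- By the standing assumption every box that i inherits from is T when i is.
  T-absorb : KT⊆ 𝒟 i → Inherits i Γ Θ → Θ ++ Γ ⊢ₛ Δ → Γ ⊢ₛ Δ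
  T-absorb kt []                    D = D
  T-absorb kt (unbox p i⪯m ∷ js)    D =
    t p (proj₂ (sa _ _ i⪯m) kt) (T-absorb kt (Inherits-mono there js) (wk (shift-⊇ _) ⊆-refl D))
  T-absorb kt (keep4 p i⪯m k4 ∷ js) D =
    wk (∈-∷⁺ʳ p ⊆-refl) ⊆-refl (T-absorb kt (Inherits-mono there js) (wk (shift-⊇ _) ⊆-refl D))

  sources : Inherits i Γ Θ → List Fo
  sources []                                 = []
  sources (unbox {i = m} {A = B} _ _ ∷ js)   = □ m B ∷ sources js
  sources (keep4 {i = m} {A = B} _ _ _ ∷ js) = □ m B ∷ sources js

  Inherits-sources : (js : Inherits i Γ Θ) → Inherits i (sources js) Θ
  Inherits-sources []                    = []
  Inherits-sources (unbox _ i⪯m ∷ js)    =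
    unbox (here refl) i⪯m ∷ Inherits-mono there (Inherits-sources js)
  Inherits-sources (keep4 _ i⪯m k4 ∷ js) =
    keep4 (here refl) i⪯m k4 ∷ Inherits-mono there (Inherits-sources js)

  -- Every source □ₘ B has i ⪯ m, so it is K4 by transitive-closedness.
  sources-inherited : k ⪯ i → K4⊆ 𝒟 i → (js : Inherits i Γ Θ) → Inherits k Γ (sources js)
  sources-inherited k⪯i k4 []                     = []
  sources-inherited k⪯i k4 (unbox p i⪯m ∷ js)     =
    keep4 p (⪯-trans k⪯i i⪯m) (tc _ _ i⪯m k4) ∷ sources-inherited k⪯i k4 js
  sources-inherited k⪯i k4 (keep4 p i⪯m k4m ∷ js) =
    keep4 p (⪯-trans k⪯i i⪯m) k4m ∷ sources-inherited k⪯i k4 js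

  seriality : KD⊆ 𝒟 j → ModalPremiss j Γ [] → Γ ⊢ₛ Δ
  seriality kd (_ , []                     , D) = wk (λ ()) (λ ()) D
  seriality kd (_ , js@(unbox p j⪯m ∷ _)   , D) = d p j⪯m kd js (wk (xs⊆xs++ys _ _) ⊆-refl D)
  seriality kd (_ , js@(keep4 p j⪯m _ ∷ _) , D) = d p j⪯m kd js (wk (xs⊆xs++ys _ _) ⊆-refl D)

  -- What a derivation of Γ ⇒ C, Δ ending with C principal provides.
  RightIntro : Fo → List Fo → List Fo → Set
  RightIntro (var n)  Γ Δ = var n ∈ Γ
  RightIntro ⊥'       Γ Δ = ⊥
  RightIntro ⊤'       Γ Δ = ⊤
  RightIntro (¬' A)   Γ Δ = A ∷ Γ ⊢ₛ Δ
  RightIntro (A ∧' B) Γ Δ = (Γ ⊢ₛ A ∷ Δ) × (Γ ⊢ₛ B ∷ Δ)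
  RightIntro (A ∨' B) Γ Δ = Γ ⊢ₛ A ∷ B ∷ Δ
  RightIntro (A ⇒' B) Γ Δ = A ∷ Γ ⊢ₛ B ∷ Δ
  RightIntro (□ i A)  Γ Δ = ModalPremiss i Γ [ A ]

  intro-right : ∀ C → C ∈ Δ → RightIntro C Γ Δ → Γ ⊢ₛ Δ
  intro-right (var n)  q p            = init p q
  intro-right ⊤'       q _            = ⊤R q
  intro-right (¬' A)   q D            = ¬R q D
  intro-right (A ∧' B) q (D₁ , D₂)    = ∧R q D₁ D₂
  intro-right (A ∨' B) q D            = ∨R q D
  intro-right (A ⇒' B) q D            = ⇒R q D
  intro-right (□ i A)  q (_ , js , D) = □R q js D

  RightIntro-mono : ∀ C → Γ ⊆ Γ′ → Δ ⊆ Δ′ → RightIntro C Γ Δ → RightIntro C Γ′ Δ′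
  RightIntro-mono (var n)  γ δ p            = γ p
  RightIntro-mono ⊤'       γ δ _            = tt
  RightIntro-mono (¬' A)   γ δ D            = wk (∷⁺ʳ _ γ) δ D
  RightIntro-mono (A ∧' B) γ δ (D₁ , D₂)    = wk γ (∷⁺ʳ _ δ) D₁ , wk γ (∷⁺ʳ _ δ) D₂
  RightIntro-mono (A ∨' B) γ δ D            = wk γ (∷⁺ʳ _ (∷⁺ʳ _ δ)) D
  RightIntro-mono (A ⇒' B) γ δ D            = wk (∷⁺ʳ _ γ) (∷⁺ʳ _ δ) D
  RightIntro-mono (□ i A)  γ δ (Θ , js , D) = Θ , Inherits-mono γ js , D

  RightIntro-wkL : ∀ C → RightIntro C Γ Δ → RightIntro C (A ∷ Γ) Δ
  RightIntro-wkL C = RightIntro-mono C there ⊆-refl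

  RightIntro-wkR : ∀ C → RightIntro C Γ Δ → RightIntro C Γ (A ∷ Δ)
  RightIntro-wkR C = RightIntro-mono C ⊆-refl there

  -- How an inherited list Θ relates to the cut formula □ i A in the conclusion.
  data BoxSplit (k i : Idx) (A : Fo) (Γ Θ : List Fo) : Set where
    untouched : Inherits k Γ Ξ → Θ ⊆ Ξ → BoxSplit k i A Γ Θ
    unboxed   : k ⪯ i → Inherits k Γ Ξ → Θ ⊆ A ∷ Ξ → BoxSplit k i A Γ Θ
    kept4     : k ⪯ i → K4⊆ 𝒟 i → Inherits k Γ Ξ → Θ ⊆ A ∷ □ i A ∷ Ξ → BoxSplit k i A Γ Θ

  private
    split-∷ : Inherited k Γ B → BoxSplit k i A Γ Θ → BoxSplit k i A Γ (B ∷ Θ)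
    split-∷ j (untouched js v)    = untouched (j ∷ js) (∷⁺ʳ _ v)
    split-∷ j (unboxed k⪯i js v)  =
      unboxed k⪯i (j ∷ js) (∈-∷⁺ʳ (there (here refl)) (⊆-under [ _ ] v))
    split-∷ j (kept4 k⪯i k4 js v) =
      kept4 k⪯i k4 (j ∷ js) (∈-∷⁺ʳ (there (there (here refl))) (⊆-trans v (∷⁺ʳ _ (∷⁺ʳ _ there))))

    split-A : k ⪯ i → BoxSplit k i A Γ Θ → BoxSplit k i A Γ (A ∷ Θ)
    split-A k⪯i (untouched js v)     = unboxed k⪯i js (∷⁺ʳ _ v)
    split-A k⪯i (unboxed _ js v)     = unboxed k⪯i js (∈-∷⁺ʳ (here refl) v)
    split-A k⪯i (kept4 k⪯i′ k4 js v) = kept4 k⪯i′ k4 js (∈-∷⁺ʳ (here refl) v)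

    split-□ : k ⪯ i → K4⊆ 𝒟 i → BoxSplit k i A Γ Θ → BoxSplit k i A Γ (□ i A ∷ Θ)
    split-□ k⪯i k4 (untouched js v)   = kept4 k⪯i k4 js (∈-∷⁺ʳ (there (here refl)) (there ∘ there ∘ v))
    split-□ k⪯i k4 (unboxed _ js v)   = kept4 k⪯i k4 js (∈-∷⁺ʳ (there (here refl)) (⊆-under [ _ ] v))
    split-□ k⪯i k4 (kept4 _ k4′ js v) = kept4 k⪯i k4′ js (∈-∷⁺ʳ (there (here refl)) v)

  split : Γ′ ⊆ □ i A ∷ Γ → Inherits k Γ′ Θ → BoxSplit k i A Γ Θ
  split γ [] = untouched [] (λ ())
  split γ (unbox p k⪯m ∷ js) with γ p
  ... | here refl = split-A k⪯m (split γ js)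
  ... | there p′  = split-∷ (unbox p′ k⪯m) (split γ js)
  split γ (keep4 p k⪯m k4 ∷ js) with γ p
  ... | here refl = split-□ k⪯m k4 (split γ js)
  ... | there p′  = split-∷ (keep4 p′ k⪯m k4) (split γ js)

  NotBox : Fo → Set
  NotBox (□ _ _) = ⊥
  NotBox _       = ⊤

  Inherits-skip : NotBox C → Γ′ ⊆ C ∷ Γ → Inherits k Γ′ Θ → Inherits k Γ Θ
  Inherits-skip nb γ [] = []
  Inherits-skip nb γ (unbox p k⪯m ∷ js) with γ p
  ... | here refl = ⊥-elim nb
  ... | there p′  = unbox p′ k⪯m ∷ Inherits-skip nb γ js
  Inherits-skip nb γ (keep4 p k⪯m k4 ∷ js) with γ p
  ... | here refl = ⊥-elim nb
  ... | there p′  = keep4 p′ k⪯m k4 ∷ Inherits-skip nb γ js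

  CutAt : Fo → Set
  CutAt C = ∀ {Γₗ Δₗ Γᵣ Δᵣ Γ Δ} → Γₗ ⊢ₛ Δₗ → Γᵣ ⊢ₛ Δᵣ →
            Γₗ ⊆ Γ → Δₗ ⊆ C ∷ Δ → Γᵣ ⊆ C ∷ Γ → Δᵣ ⊆ Δ → Γ ⊢ₛ Δ

  -- Cutting □ i A into a modal premiss: an inherited A is cut against the premiss of □ i A,
  -- whose own inherited formulas then come from Γ through k ⪯ i; an inherited □ i A is first
  -- removed by a cut on □ i A against the smaller derivation, the sources of the premiss of
  -- □ i A being inherited through axiom 4.
  box-premiss : ∀ {Π} → ModalPremiss i Γ [ A ] → BoxSplit k i A Γ Θ → Θ ⊢ₛ Π → CutAt A →
                (∀ {Γ′} → ModalPremiss i Γ′ [ A ] → Θ ⊆ □ i A ∷ Γ′ → Γ′ ⊢ₛ Π) → ModalPremiss k Γ Π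
  box-premiss _ (untouched js v) D _ _ = _ , js , wk v ⊆-refl D
  box-premiss (Θ , jsΘ , Dₐ) (unboxed {Ξ = Ξ} k⪯i js v) D cutA _ =
    Θ ++ Ξ , All.++⁺ (All.map (Inherited-lower k⪯i) jsΘ) js ,
    cutA Dₐ D (xs⊆xs++ys _ _) (∈-∷⁺ʳ (here refl) (λ ())) (⊆-trans v (∷⁺ʳ _ (xs⊆ys++xs Ξ Θ))) ⊆-refl
  box-premiss (Θ , jsΘ , Dₐ) (kept4 {Ξ = Ξ} k⪯i k4 js v) D cutA cut□ =
    Θ ++ sources jsΘ ++ Ξ ,
    All.++⁺ (All.map (Inherited-lower k⪯i) jsΘ) (All.++⁺ (sources-inherited k⪯i k4 jsΘ) js) ,
    cutA Dₐ (cut□ (Θ , Inherits-mono (there ∘ xs⊆ys++xs _ Θ ∘ xs⊆xs++ys _ Ξ) (Inherits-sources jsΘ) , Dₐ)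
                  (⊆-trans v (∈-∷⁺ʳ (there (here refl)) (∈-∷⁺ʳ (here refl)
                    (there ∘ there ∘ xs⊆ys++xs _ Θ ∘ xs⊆ys++xs Ξ (sources jsΘ))))))
         (xs⊆xs++ys _ _) (∈-∷⁺ʳ (here refl) (λ ())) ⊆-refl ⊆-refl

  private
    principal-or-side : ∀ {X} → X ∈ C ∷ Δ → RightIntro X Γ Δ → (RightIntro C Γ Δ → Γ ⊢ₛ Δ) → Γ ⊢ₛ Δ
    principal-or-side (here refl) ri k = k ri
    principal-or-side (there q)   ri _ = intro-right _ q ri

  -- The left derivation is followed until C becomes principal on its right (cut), then the
  -- right one until C is principal on its left (cut-intro), where the cut moves to subformulas.
  mutual
    cut : ∀ C → CutAt C
    cut C (init p q)        Dᵣ γₗ δₗ γᵣ δᵣ =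
      principal-or-side (δₗ q) (γₗ p) λ ri → cut-intro C ri Dᵣ γᵣ δᵣ
    cut C (⊥L p)            Dᵣ γₗ δₗ γᵣ δᵣ = ⊥L (γₗ p)
    cut C (⊤R q)            Dᵣ γₗ δₗ γᵣ δᵣ =
      principal-or-side (δₗ q) tt λ ri → cut-intro C ri Dᵣ γᵣ δᵣ
    cut C (¬L p D)          Dᵣ γₗ δₗ γᵣ δᵣ =
      ¬L (γₗ p) (cut C D Dᵣ γₗ (++-⊆-under [ _ ] δₗ) γᵣ (there ∘ δᵣ))
    cut C (¬R q D)          Dᵣ γₗ δₗ γᵣ δᵣ =
      principal-or-side (δₗ q) (cut C D Dᵣ (∷⁺ʳ _ γₗ) δₗ (⊆-under [ _ ] γᵣ) δᵣ)
        λ ri → cut-intro C ri Dᵣ γᵣ δᵣ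
    cut C (∧L p D)          Dᵣ γₗ δₗ γᵣ δᵣ =
      ∧L (γₗ p) (cut C D Dᵣ (∷⁺ʳ _ (∷⁺ʳ _ γₗ)) δₗ (⊆-under (_ ∷ _ ∷ []) γᵣ) δᵣ)
    cut C (∧R q D₁ D₂)      Dᵣ γₗ δₗ γᵣ δᵣ =
      principal-or-side (δₗ q) ( cut C D₁ Dᵣ γₗ (++-⊆-under [ _ ] δₗ) γᵣ (there ∘ δᵣ)
                               , cut C D₂ Dᵣ γₗ (++-⊆-under [ _ ] δₗ) γᵣ (there ∘ δᵣ))
        λ ri → cut-intro C ri Dᵣ γᵣ δᵣ
    cut C (∨L p D₁ D₂)      Dᵣ γₗ δₗ γᵣ δᵣ =
      ∨L (γₗ p) (cut C D₁ Dᵣ (∷⁺ʳ _ γₗ) δₗ (⊆-under [ _ ] γᵣ) δᵣ)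
                (cut C D₂ Dᵣ (∷⁺ʳ _ γₗ) δₗ (⊆-under [ _ ] γᵣ) δᵣ)
    cut C (∨R q D)          Dᵣ γₗ δₗ γᵣ δᵣ =
      principal-or-side (δₗ q) (cut C D Dᵣ γₗ (++-⊆-under (_ ∷ _ ∷ []) δₗ) γᵣ (there ∘ there ∘ δᵣ))
        λ ri → cut-intro C ri Dᵣ γᵣ δᵣ
    cut C (⇒L p D₁ D₂)      Dᵣ γₗ δₗ γᵣ δᵣ =
      ⇒L (γₗ p) (cut C D₁ Dᵣ (∷⁺ʳ _ γₗ) δₗ (⊆-under [ _ ] γᵣ) δᵣ)
                (cut C D₂ Dᵣ γₗ (++-⊆-under [ _ ] δₗ) γᵣ (there ∘ δᵣ))
    cut C (⇒R q D)          Dᵣ γₗ δₗ γᵣ δᵣ =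
      principal-or-side (δₗ q)
        (cut C D Dᵣ (∷⁺ʳ _ γₗ) (++-⊆-under [ _ ] δₗ) (⊆-under [ _ ] γᵣ) (there ∘ δᵣ))
        λ ri → cut-intro C ri Dᵣ γᵣ δᵣ
    cut C (□R q js D)       Dᵣ γₗ δₗ γᵣ δᵣ =
      principal-or-side (δₗ q) (_ , Inherits-mono γₗ js , D) λ ri → cut-intro C ri Dᵣ γᵣ δᵣ
    cut C (d p j⪯l kd js D) Dᵣ γₗ δₗ γᵣ δᵣ = d (γₗ p) j⪯l kd (Inherits-mono γₗ js) D
    cut C (t p kt D)        Dᵣ γₗ δₗ γᵣ δᵣ =
      t (γₗ p) kt (cut C D Dᵣ (∷⁺ʳ _ γₗ) δₗ (⊆-under [ _ ] γᵣ) δᵣ)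

    cut-admissible : ∀ C → Γ ⊢ₛ C ∷ Δ → C ∷ Γ ⊢ₛ Δ → Γ ⊢ₛ Δ
    cut-admissible C Dₗ Dᵣ = cut C Dₗ Dᵣ ⊆-refl ⊆-refl ⊆-refl ⊆-refl

    cut-intro : ∀ C {Γᵣ Δᵣ Γ Δ} → RightIntro C Γ Δ → Γᵣ ⊢ₛ Δᵣ → Γᵣ ⊆ C ∷ Γ → Δᵣ ⊆ Δ → Γ ⊢ₛ Δ
    cut-intro C ri (init p q) γ δ with γ p
    ... | here refl = init ri (δ q)
    ... | there p′  = init p′ (δ q)
    cut-intro C ri (⊥L p) γ δ with γ p
    ... | here refl = ⊥-elim ri
    ... | there p′  = ⊥L p′
    cut-intro C ri (⊤R q) γ δ = ⊤R (δ q)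
    cut-intro C ri (¬L {A = A} p D) γ δ with γ p
    ... | here refl = cut-admissible A (cut-intro (¬' A) (RightIntro-wkR (¬' A) ri) D γ (∷⁺ʳ _ δ)) ri
    ... | there p′  = ¬L p′ (cut-intro C (RightIntro-wkR C ri) D γ (∷⁺ʳ _ δ))
    cut-intro C ri (¬R q D) γ δ =
      ¬R (δ q) (cut-intro C (RightIntro-wkL C ri) D (++-⊆-under [ _ ] γ) δ)
    cut-intro C ri (∧L {A = A} {B = B} p D) γ δ with γ p
    ... | here refl =
          let a , b = ri
              rest = cut-intro (A ∧' B) (RightIntro-wkL (A ∧' B) (RightIntro-wkL (A ∧' B) ri)) D
                               (++-⊆-under (_ ∷ _ ∷ []) γ) δ
          in cut-admissible A a (cut B b rest there ⊆-refl (⊆-reflexive-↭ (↭.swap _ _ ↭.refl)) ⊆-refl)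
    ... | there p′  =
          ∧L p′ (cut-intro C (RightIntro-wkL C (RightIntro-wkL C ri)) D (++-⊆-under (_ ∷ _ ∷ []) γ) δ)
    cut-intro C ri (∧R q D₁ D₂) γ δ =
      ∧R (δ q) (cut-intro C (RightIntro-wkR C ri) D₁ γ (∷⁺ʳ _ δ))
               (cut-intro C (RightIntro-wkR C ri) D₂ γ (∷⁺ʳ _ δ))
    cut-intro C ri (∨L {A = A} {B = B} p D₁ D₂) γ δ with γ p
    ... | here refl =
          let left  = cut-intro (A ∨' B) (RightIntro-wkL (A ∨' B) ri) D₁ (++-⊆-under [ _ ] γ) δ
              right = cut-intro (A ∨' B) (RightIntro-wkL (A ∨' B) ri) D₂ (++-⊆-under [ _ ] γ) δ
          in cut-admissible A (cut B ri right ⊆-refl (⊆-reflexive-↭ (↭.swap _ _ ↭.refl)) ⊆-refl there) left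
    ... | there p′  =
          ∨L p′ (cut-intro C (RightIntro-wkL C ri) D₁ (++-⊆-under [ _ ] γ) δ)
                (cut-intro C (RightIntro-wkL C ri) D₂ (++-⊆-under [ _ ] γ) δ)
    cut-intro C ri (∨R q D) γ δ =
      ∨R (δ q) (cut-intro C (RightIntro-wkR C (RightIntro-wkR C ri)) D γ (∷⁺ʳ _ (∷⁺ʳ _ δ)))
    cut-intro C ri (⇒L {A = A} {B = B} p D₁ D₂) γ δ with γ p
    ... | here refl =
          let left  = cut-intro (A ⇒' B) (RightIntro-wkL (A ⇒' B) ri) D₁ (++-⊆-under [ _ ] γ) δ
              right = cut-intro (A ⇒' B) (RightIntro-wkR (A ⇒' B) ri) D₂ γ (∷⁺ʳ _ δ)
          in cut-admissible A right (cut B ri left ⊆-refl ⊆-refl (∷⁺ʳ _ there) ⊆-refl)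
    ... | there p′  =
          ⇒L p′ (cut-intro C (RightIntro-wkL C ri) D₁ (++-⊆-under [ _ ] γ) δ)
                (cut-intro C (RightIntro-wkR C ri) D₂ γ (∷⁺ʳ _ δ))
    cut-intro C ri (⇒R q D) γ δ =
      ⇒R (δ q) (cut-intro C (RightIntro-wkL C (RightIntro-wkR C ri)) D (++-⊆-under [ _ ] γ) (∷⁺ʳ _ δ))
    cut-intro C ri (t {i = i} {A = A} p kt D) γ δ with γ p
    ... | here refl =
          let Θ , js , Dₐ = ri
              rest = cut-intro (□ i A) (Θ , Inherits-mono there js , Dₐ) D (++-⊆-under [ _ ] γ) δ
          in cut-admissible A (T-absorb kt js (wk (xs⊆xs++ys _ _) (∈-∷⁺ʳ (here refl) (λ ())) Dₐ)) rest
    ... | there p′  = t p′ kt (cut-intro C (RightIntro-wkL C ri) D (++-⊆-under [ _ ] γ) δ)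
    cut-intro C ri (□R q js D) γ δ =
      let _ , js′ , D′ = modal-premiss C ri γ js D in □R (δ q) js′ D′
    cut-intro C ri (d p j⪯l kd js D) γ δ =
      seriality kd (modal-premiss C ri γ (All.++⁺ js (unbox p j⪯l ∷ [])) D)

    modal-premiss : ∀ C {Γᵣ Γ Δ Π} → RightIntro C Γ Δ → Γᵣ ⊆ C ∷ Γ →
                    Inherits k Γᵣ Θ → Θ ⊢ₛ Π → ModalPremiss k Γ Π
    modal-premiss (□ i A) ri γ js D =
      box-premiss ri (split γ js) D (cut A) (λ ri′ γ′ → cut-intro (□ i A) ri′ D γ′ ⊆-refl)
    modal-premiss (var _)  _ γ js D = _ , Inherits-skip tt γ js , D
    modal-premiss ⊥'       _ γ js D = _ , Inherits-skip tt γ js , D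
    modal-premiss ⊤'       _ γ js D = _ , Inherits-skip tt γ js , D
    modal-premiss (¬' _)   _ γ js D = _ , Inherits-skip tt γ js , D
    modal-premiss (_ ∧' _) _ γ js D = _ , Inherits-skip tt γ js , D
    modal-premiss (_ ∨' _) _ γ js D = _ , Inherits-skip tt γ js , D
    modal-premiss (_ ⇒' _) _ γ js D = _ , Inherits-skip tt γ js , D

-- Propositional completeness of the shallow calculus

-- Decidable equality is needed only to read the countermodel off a saturated sequent.
∈-≟ : ∀ {n : ℕ} {ns : List ℕ} → DecidableEquality (n ∈ ns)
∈-≟ (here p)  (here q)  = yes (cong here (ℕ.≡-irrelevant p q))
∈-≟ (here _)  (there _) = no λ ()
∈-≟ (there _) (here _)  = no λ ()
∈-≟ (there p) (there q) = map′ (cong there) (λ where refl → refl) (∈-≟ p q)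

Idx-≟ : (𝒟 : Description) → DecidableEquality (Description.Idx 𝒟)
Idx-≟ 𝒟 = ≡-dec ℕ._≟_ ∈-≟

module _ {I : Set} (_≟ᵢ_ : DecidableEquality I) where

  private
    by-parts : ∀ {X Y : Set} {x x′ : X} {y y′ : Y} {c : X → Y → Fm I} →
               (c x y ≡ c x′ y′ → x ≡ x′ × y ≡ y′) → Dec (x ≡ x′) → Dec (y ≡ y′) → Dec (c x y ≡ c x′ y′)
    by-parts inj x≟ y≟ = map′ (λ where (refl , refl) → refl) inj (x≟ ×-dec y≟)

  Fm-≟ : DecidableEquality (Fm I)
  Fm-≟ (var m)  (var n)    = map′ (cong var) (λ where refl → refl) (m ℕ.≟ n)
  Fm-≟ (var _)  ⊥'         = no λ ()
  Fm-≟ (var _)  ⊤'         = no λ ()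
  Fm-≟ (var _)  (¬' _)     = no λ ()
  Fm-≟ (var _)  (_ ∧' _)   = no λ ()
  Fm-≟ (var _)  (_ ∨' _)   = no λ ()
  Fm-≟ (var _)  (_ ⇒' _)   = no λ ()
  Fm-≟ (var _)  (□ _ _)    = no λ ()
  Fm-≟ ⊥'       (var _)    = no λ ()
  Fm-≟ ⊥'       ⊥'         = yes refl
  Fm-≟ ⊥'       ⊤'         = no λ ()
  Fm-≟ ⊥'       (¬' _)     = no λ ()
  Fm-≟ ⊥'       (_ ∧' _)   = no λ ()
  Fm-≟ ⊥'       (_ ∨' _)   = no λ ()
  Fm-≟ ⊥'       (_ ⇒' _)   = no λ ()
  Fm-≟ ⊥'       (□ _ _)    = no λ ()
  Fm-≟ ⊤'       (var _)    = no λ ()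
  Fm-≟ ⊤'       ⊥'         = no λ ()
  Fm-≟ ⊤'       ⊤'         = yes refl
  Fm-≟ ⊤'       (¬' _)     = no λ ()
  Fm-≟ ⊤'       (_ ∧' _)   = no λ ()
  Fm-≟ ⊤'       (_ ∨' _)   = no λ ()
  Fm-≟ ⊤'       (_ ⇒' _)   = no λ ()
  Fm-≟ ⊤'       (□ _ _)    = no λ ()
  Fm-≟ (¬' _)   (var _)    = no λ ()
  Fm-≟ (¬' _)   ⊥'         = no λ ()
  Fm-≟ (¬' _)   ⊤'         = no λ ()
  Fm-≟ (¬' A)   (¬' A′)    = map′ (cong ¬'_) (λ where refl → refl) (Fm-≟ A A′)
  Fm-≟ (¬' _)   (_ ∧' _)   = no λ ()
  Fm-≟ (¬' _)   (_ ∨' _)   = no λ ()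
  Fm-≟ (¬' _)   (_ ⇒' _)   = no λ ()
  Fm-≟ (¬' _)   (□ _ _)    = no λ ()
  Fm-≟ (_ ∧' _) (var _)    = no λ ()
  Fm-≟ (_ ∧' _) ⊥'         = no λ ()
  Fm-≟ (_ ∧' _) ⊤'         = no λ ()
  Fm-≟ (_ ∧' _) (¬' _)     = no λ ()
  Fm-≟ (A ∧' B) (A′ ∧' B′) = by-parts (λ where refl → refl , refl) (Fm-≟ A A′) (Fm-≟ B B′)
  Fm-≟ (_ ∧' _) (_ ∨' _)   = no λ ()
  Fm-≟ (_ ∧' _) (_ ⇒' _)   = no λ ()
  Fm-≟ (_ ∧' _) (□ _ _)    = no λ ()
  Fm-≟ (_ ∨' _) (var _)    = no λ ()
  Fm-≟ (_ ∨' _) ⊥'         = no λ ()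
  Fm-≟ (_ ∨' _) ⊤'         = no λ ()
  Fm-≟ (_ ∨' _) (¬' _)     = no λ ()
  Fm-≟ (_ ∨' _) (_ ∧' _)   = no λ ()
  Fm-≟ (A ∨' B) (A′ ∨' B′) = by-parts (λ where refl → refl , refl) (Fm-≟ A A′) (Fm-≟ B B′)
  Fm-≟ (_ ∨' _) (_ ⇒' _)   = no λ ()
  Fm-≟ (_ ∨' _) (□ _ _)    = no λ ()
  Fm-≟ (_ ⇒' _) (var _)    = no λ ()
  Fm-≟ (_ ⇒' _) ⊥'         = no λ ()
  Fm-≟ (_ ⇒' _) ⊤'         = no λ ()
  Fm-≟ (_ ⇒' _) (¬' _)     = no λ ()
  Fm-≟ (_ ⇒' _) (_ ∧' _)   = no λ ()
  Fm-≟ (_ ⇒' _) (_ ∨' _)   = no λ ()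
  Fm-≟ (A ⇒' B) (A′ ⇒' B′) = by-parts (λ where refl → refl , refl) (Fm-≟ A A′) (Fm-≟ B B′)
  Fm-≟ (_ ⇒' _) (□ _ _)    = no λ ()
  Fm-≟ (□ _ _)  (var _)    = no λ ()
  Fm-≟ (□ _ _)  ⊥'         = no λ ()
  Fm-≟ (□ _ _)  ⊤'         = no λ ()
  Fm-≟ (□ _ _)  (¬' _)     = no λ ()
  Fm-≟ (□ _ _)  (_ ∧' _)   = no λ ()
  Fm-≟ (□ _ _)  (_ ∨' _)   = no λ ()
  Fm-≟ (□ _ _)  (_ ⇒' _)   = no λ ()
  Fm-≟ (□ i A)  (□ i′ A′)  = by-parts (λ where refl → refl , refl) (i ≟ᵢ i′) (Fm-≟ A A′)

module Tautologies (𝒟 : Description) where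
  open ShallowCalculus 𝒟
  open DecMembership (Fm-≟ (Idx-≟ 𝒟)) using (_∈?_)

  Valid : List Fo → List Fo → Set
  Valid Γ Δ = ∀ (ρ : Valuation Idx) → All (ρ ⊨_) Γ → Any (ρ ⊨_) Δ

  Valid-mono : Γ ⊆ Γ′ → Δ ⊆ Δ′ → Valid Γ Δ → Valid Γ′ Δ′
  Valid-mono γ δ v ρ = Any-resp-⊆ δ ∘ v ρ ∘ All-resp-⊇ γ

  data Atomic : Fo → Set where
    var : Atomic (var n)
    box : Atomic (□ i A)

  -- Completeness of Γ ⇒ Δ alongside any atomic side formulas, which the decomposition of
  -- Γ ⇒ Δ accumulates.
  Complete : List Fo → List Fo → Set
  Complete Γ Δ = ∀ {Γₐ Δₐ} → All Atomic Γₐ → All Atomic Δₐ →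
                 Valid (Γ ++ Γₐ) (Δ ++ Δₐ) → Γ ++ Γₐ ⊢ₛ Δ ++ Δₐ

  countermodel : List Fo → Valuation Idx
  countermodel Γ = ⟨ (λ n → isYes (var n ∈? Γ)) , (λ i A → isYes (□ i A ∈? Γ)) ⟩

  countermodel-⊨ : Atomic A → A ∈ Γ → countermodel Γ ⊨ A
  countermodel-⊨ var p = holds (fromWitness p)
  countermodel-⊨ box p = holds (fromWitness p)

  countermodel-∈ : Atomic A → countermodel Γ ⊨ A → A ∈ Γ
  countermodel-∈ var h = toWitness (truth h)
  countermodel-∈ box h = toWitness (truth h)

  atoms-complete : Complete [] []
  atoms-complete {Γₐ} aΓ aΔ v
    with A , q , h ← find (v (countermodel Γₐ) (All.tabulate λ p → countermodel-⊨ (All.lookup aΓ p) p))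
    = ⊢ₛ-id A (countermodel-∈ (All.lookup aΔ q) h) q

  atomL-complete : Atomic A → Complete Γ Δ → Complete (A ∷ Γ) Δ
  atomL-complete {Γ = Γ} a c aΓ aΔ v =
    wk (shift-⊆ Γ) ⊆-refl (c (a ∷ aΓ) aΔ (Valid-mono (shift-⊇ Γ) ⊆-refl v))

  atomR-complete : Atomic A → Complete Γ Δ → Complete Γ (A ∷ Δ)
  atomR-complete {Δ = Δ} a c aΓ aΔ v =
    wk ⊆-refl (shift-⊆ Δ) (c aΓ (a ∷ aΔ) (Valid-mono ⊆-refl (shift-⊇ Δ) v))

  Valid-⊤L⁻ : Valid (⊤' ∷ Γ) Δ → Valid Γ Δ
  Valid-⊤L⁻ v ρ as = v ρ (⊨⊤ ∷ as)

  Valid-⊥R⁻ : Valid Γ (⊥' ∷ Δ) → Valid Γ Δ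
  Valid-⊥R⁻ v ρ as with v ρ as
  ... | there y = y

  Valid-¬L⁻ : Valid (¬' A ∷ Γ) Δ → Valid Γ (A ∷ Δ)
  Valid-¬L⁻ {A} v ρ as with ⊨? A
  ... | yes a = here a
  ... | no na = there (v ρ (from ⊨¬ na ∷ as))

  Valid-¬R⁻ : Valid Γ (¬' A ∷ Δ) → Valid (A ∷ Γ) Δ
  Valid-¬R⁻ v ρ (a ∷ as) with v ρ as
  ... | here n  = ⊥-elim (to ⊨¬ n a)
  ... | there y = y

  Valid-∧L⁻ : Valid (A ∧' B ∷ Γ) Δ → Valid (A ∷ B ∷ Γ) Δ
  Valid-∧L⁻ v ρ (a ∷ b ∷ as) = v ρ (from ⊨∧ (a , b) ∷ as)

  private
    on-head : ∀ {ρ : Valuation Idx} → (ρ ⊨ A → ρ ⊨ B) → Any (ρ ⊨_) (A ∷ Δ) → Any (ρ ⊨_) (B ∷ Δ)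
    on-head f (here a)  = here (f a)
    on-head f (there y) = there y

  Valid-∧R⁻ : Valid Γ (A ∧' B ∷ Δ) → Valid Γ (A ∷ Δ) × Valid Γ (B ∷ Δ)
  Valid-∧R⁻ v = (λ ρ → on-head (proj₁ ∘ to ⊨∧) ∘ v ρ) , (λ ρ → on-head (proj₂ ∘ to ⊨∧) ∘ v ρ)

  Valid-∨L⁻ : Valid (A ∨' B ∷ Γ) Δ → Valid (A ∷ Γ) Δ × Valid (B ∷ Γ) Δ
  Valid-∨L⁻ v = (λ where ρ (a ∷ as) → v ρ (from ⊨∨ (inj₁ a) ∷ as))
              , (λ where ρ (b ∷ as) → v ρ (from ⊨∨ (inj₂ b) ∷ as))

  Valid-∨R⁻ : Valid Γ (A ∨' B ∷ Δ) → Valid Γ (A ∷ B ∷ Δ)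
  Valid-∨R⁻ v ρ as with v ρ as
  ... | there y = there (there y)
  ... | here ab with to ⊨∨ ab
  ...   | inj₁ a = here a
  ...   | inj₂ b = there (here b)

  Valid-⇒L⁻ : Valid (A ⇒' B ∷ Γ) Δ → Valid (B ∷ Γ) Δ × Valid Γ (A ∷ Δ)
  Valid-⇒L⁻ {A = A} v = (λ where ρ (b ∷ as) → v ρ (from ⊨⇒ (const b) ∷ as)) , by-cases
    where
    by-cases : Valid _ (A ∷ _)
    by-cases ρ as with ⊨? A
    ... | yes a = here a
    ... | no na = there (v ρ (from ⊨⇒ (⊥-elim ∘ na) ∷ as))

  Valid-⇒R⁻ : Valid Γ (A ⇒' B ∷ Δ) → Valid (A ∷ Γ) (B ∷ Δ)
  Valid-⇒R⁻ v ρ (a ∷ as) = on-head (λ f → to ⊨⇒ f a) (v ρ as)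

  mutual
    completeL : ∀ A → Complete Γ Δ → Complete (A ∷ Γ) Δ
    completeL (var _)  c          = atomL-complete var c
    completeL (□ _ _)  c          = atomL-complete box c
    completeL ⊥'       c _  _  _  = ⊥L (here refl)
    completeL ⊤'       c aΓ aΔ v  = wk there ⊆-refl (c aΓ aΔ (Valid-⊤L⁻ v))
    completeL (¬' A)   c aΓ aΔ v  =
      ¬L (here refl) (wk there ⊆-refl (completeR A c aΓ aΔ (Valid-¬L⁻ v)))
    completeL (A ∧' B) c aΓ aΔ v  =
      ∧L (here refl) (wk (∷⁺ʳ _ (∷⁺ʳ _ there)) ⊆-refl (completeL A (completeL B c) aΓ aΔ (Valid-∧L⁻ v)))
    completeL (A ∨' B) c aΓ aΔ v  = let vA , vB = Valid-∨L⁻ v in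
      ∨L (here refl) (wk (∷⁺ʳ _ there) ⊆-refl (completeL A c aΓ aΔ vA))
                     (wk (∷⁺ʳ _ there) ⊆-refl (completeL B c aΓ aΔ vB))
    completeL (A ⇒' B) c aΓ aΔ v  = let vB , vA = Valid-⇒L⁻ v in
      ⇒L (here refl) (wk (∷⁺ʳ _ there) ⊆-refl (completeL B c aΓ aΔ vB))
                     (wk there ⊆-refl (completeR A c aΓ aΔ vA))

    completeR : ∀ A → Complete Γ Δ → Complete Γ (A ∷ Δ)
    completeR (var _)  c          = atomR-complete var c
    completeR (□ _ _)  c          = atomR-complete box c
    completeR ⊤'       c _  _  _  = ⊤R (here refl)
    completeR ⊥'       c aΓ aΔ v  = wk ⊆-refl there (c aΓ aΔ (Valid-⊥R⁻ v))
    completeR (¬' A)   c aΓ aΔ v  =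
      ¬R (here refl) (wk ⊆-refl there (completeL A c aΓ aΔ (Valid-¬R⁻ v)))
    completeR (A ∧' B) c aΓ aΔ v  = let vA , vB = Valid-∧R⁻ v in
      ∧R (here refl) (wk ⊆-refl (∷⁺ʳ _ there) (completeR A c aΓ aΔ vA))
                     (wk ⊆-refl (∷⁺ʳ _ there) (completeR B c aΓ aΔ vB))
    completeR (A ∨' B) c aΓ aΔ v  =
      ∨R (here refl) (wk ⊆-refl (∷⁺ʳ _ (∷⁺ʳ _ there)) (completeR A (completeR B c) aΓ aΔ (Valid-∨R⁻ v)))
    completeR (A ⇒' B) c aΓ aΔ v  =
      ⇒R (here refl) (wk ⊆-refl (∷⁺ʳ _ there) (completeL A (completeR B c) aΓ aΔ (Valid-⇒R⁻ v)))

  Tautology⇒⊢ₛ : Tautology A → [] ⊢ₛ [ A ]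
  Tautology⇒⊢ₛ {A} ⊨A = completeR A atoms-complete [] [] λ ρ _ → here (holds (from T-≡ (⊨A _ _)))

-- From 𝓛 to the linear nested sequent calculus

module HilbertToShallow (𝒟 : Description) (tc : TransitiveClosed 𝒟) (sa : StandingAssumption 𝒟) where
  open ShallowCalculus 𝒟
  open CutAdmissibility 𝒟 tc sa using (cut-admissible)
  open Tautologies 𝒟 using (Tautology⇒⊢ₛ)

  𝓛⇒⊢ₛ : 𝓛 𝒟 A → [] ⊢ₛ [ A ]
  𝓛⇒⊢ₛ (taut ⊨A) = Tautology⇒⊢ₛ ⊨A
  𝓛⇒⊢ₛ (axK i A B) =
    ⇒R (here refl) (⇒R (here refl)
      (□R (here refl) (unbox (there (here refl)) ⪯-refl ∷ unbox (here refl) ⪯-refl ∷ [])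
        (⇒L (here refl) (⊢ₛ-id B (here refl) (here refl)) (⊢ₛ-id A (there (here refl)) (here refl)))))
  𝓛⇒⊢ₛ (axD i e) =
    ¬R (here refl) (d (here refl) ⪯-refl (⊆ᴸ-by-flags (λ _ → e) (λ ()) (λ ())) [] (⊥L (here refl)))
  𝓛⇒⊢ₛ (axT i A e) =
    ⇒R (here refl) (t (here refl) (⊆ᴸ-by-flags (λ ()) (λ _ → e) (λ ())) (⊢ₛ-id A (here refl) (here refl)))
  𝓛⇒⊢ₛ (ax4 i A e) =
    ⇒R (here refl) (□R (here refl) (keep4 (here refl) ⪯-refl (⊆ᴸ-by-flags (λ ()) (λ ()) (λ _ → e)) ∷ [])
      (⊢ₛ-id (□ i A) (here refl) (here refl)))
  𝓛⇒⊢ₛ (incl i j A i⪯j) =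
    ⇒R (here refl) (□R (here refl) (unbox (here refl) i⪯j ∷ []) (⊢ₛ-id A (here refl) (here refl)))
  𝓛⇒⊢ₛ (mp {A} {B} h₁ h₂) =
    cut-admissible A (wk ⊆-refl (∷⁺ʳ _ (λ ())) (𝓛⇒⊢ₛ h₂))
      (cut-admissible (A ⇒' B) (wk (λ ()) (∷⁺ʳ _ (λ ())) (𝓛⇒⊢ₛ h₁)) modus-ponens)
    where
    modus-ponens : A ⇒' B ∷ A ∷ [] ⊢ₛ [ B ]
    modus-ponens = ⇒L (here refl) (⊢ₛ-id B (here refl) (here refl)) (⊢ₛ-id A (there (here refl)) (here refl))
  𝓛⇒⊢ₛ (nec i h) = □R (here refl) [] (𝓛⇒⊢ₛ h)

∈⇒↭∷ : ∀ {X : Set} {x : X} {xs} → x ∈ xs → ∃ λ ys → xs ↭ x ∷ ys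
∈⇒↭∷ x∈xs with ys , zs , refl ← ∈-∃++ x∈xs = ys ++ zs , shift _ ys zs

ctx-∷ʳ : ∀ {I : Set} (p : Pre I) s i r → ctx (p ++ [ (s , i) ]) r ≡ ctx p (s /[ i ] r)
ctx-∷ʳ []      s i r = refl
ctx-∷ʳ (_ ∷ p) s i r = cong (_ /[ _ ]_) (ctx-∷ʳ p s i r)

module ShallowToNested (𝒟 : Description) where
  open ShallowCalculus 𝒟

  private
    variable
      p : Pre Idx
      q : Suf Idx
      Ψ Π : List Fo

  contractL : A ∈ Γ → ⊢ 𝒟 (S p (A ∷ Γ ⇒ Δ) q) → ⊢ 𝒟 (S p (Γ ⇒ Δ) q)
  contractL {p = p} {q = q} a∈Γ D with _ , π ← ∈⇒↭∷ a∈Γ =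
    ex {p = p} {q = q} (↭-sym π) ↭.refl (cL {p = p} {q = q} (ex {p = p} {q = q} (↭.prep _ π) ↭.refl D))

  contractR : A ∈ Δ → ⊢ 𝒟 (S p (Γ ⇒ A ∷ Δ) q) → ⊢ 𝒟 (S p (Γ ⇒ Δ) q)
  contractR {p = p} {q = q} a∈Δ D with _ , π ← ∈⇒↭∷ a∈Δ =
    ex {p = p} {q = q} ↭.refl (↭-sym π) (cR {p = p} {q = q} (ex {p = p} {q = q} ↭.refl (↭.prep _ π) D))

  discharge : ∀ Θ → Inherits k Γ Θ →
              ⊢ 𝒟 (ctx p ((Γ ⇒ Δ) /[ k ] last (Θ ++ Ψ ⇒ Π))) → ⊢ 𝒟 (ctx p ((Γ ⇒ Δ) /[ k ] last (Ψ ⇒ Π)))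
  discharge []      []                               D = D
  discharge {p = p} (_ ∷ Θ) (unbox {i = m} a∈Γ k⪯m ∷ js)    D =
    discharge Θ js (contractL {p = p} {q = [ (_ , _) ]} a∈Γ (□L {p = p} {q = []} m _ k⪯m D))
  discharge {p = p} (_ ∷ Θ) (keep4 {i = m} a∈Γ k⪯m k4 ∷ js) D =
    discharge Θ js (contractL {p = p} {q = [ (_ , _) ]} a∈Γ (4r {p = p} {q = []} m _ k⪯m k4 D))

  ⊢ₛ⇒⊢ : Γ ⊢ₛ Δ → ∀ p → ⊢ 𝒟 (G p (Γ ⇒ Δ))
  ⊢ₛ⇒⊢ (init {n = n} a∈Γ a∈Δ) p with _ , πΓ ← ∈⇒↭∷ a∈Γ | _ , πΔ ← ∈⇒↭∷ a∈Δ =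
    ex {p = p} {q = []} (↭-sym πΓ) (↭-sym πΔ) (init {p = p} {q = []} n)
  ⊢ₛ⇒⊢ (⊥L a∈Γ) p with _ , πΓ ← ∈⇒↭∷ a∈Γ = ex {p = p} {q = []} (↭-sym πΓ) ↭.refl (⊥L {p = p} {q = []})
  ⊢ₛ⇒⊢ (⊤R a∈Δ) p with _ , πΔ ← ∈⇒↭∷ a∈Δ = ex {p = p} {q = []} ↭.refl (↭-sym πΔ) (⊤R {p = p} {q = []})
  ⊢ₛ⇒⊢ (¬L a∈ D) p     = contractL {p = p} {q = []} a∈ (¬L {p = p} {q = []} (⊢ₛ⇒⊢ D p))
  ⊢ₛ⇒⊢ (¬R a∈ D) p     = contractR {p = p} {q = []} a∈ (¬R {p = p} {q = []} (⊢ₛ⇒⊢ D p))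
  ⊢ₛ⇒⊢ (∧L a∈ D) p     = contractL {p = p} {q = []} a∈ (∧L {p = p} {q = []} (⊢ₛ⇒⊢ D p))
  ⊢ₛ⇒⊢ (∧R a∈ D₁ D₂) p = contractR {p = p} {q = []} a∈ (∧R {p = p} {q = []} (⊢ₛ⇒⊢ D₁ p) (⊢ₛ⇒⊢ D₂ p))
  ⊢ₛ⇒⊢ (∨L a∈ D₁ D₂) p = contractL {p = p} {q = []} a∈ (∨L {p = p} {q = []} (⊢ₛ⇒⊢ D₁ p) (⊢ₛ⇒⊢ D₂ p))
  ⊢ₛ⇒⊢ (∨R a∈ D) p     = contractR {p = p} {q = []} a∈ (∨R {p = p} {q = []} (⊢ₛ⇒⊢ D p))
  ⊢ₛ⇒⊢ (⇒L a∈ D₁ D₂) p = contractL {p = p} {q = []} a∈ (⇒L {p = p} {q = []} (⊢ₛ⇒⊢ D₁ p) (⊢ₛ⇒⊢ D₂ p))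
  ⊢ₛ⇒⊢ (⇒R a∈ D) p     = contractR {p = p} {q = []} a∈ (⇒R {p = p} {q = []} (⊢ₛ⇒⊢ D p))
  ⊢ₛ⇒⊢ (t {i = i} a∈ kt D) p = contractL {p = p} {q = []} a∈ (t {p = p} {q = []} i kt (⊢ₛ⇒⊢ D p))
  ⊢ₛ⇒⊢ {Γ} {Δ} (□R {k = k} {A = A} {Θ = Θ} a∈ js D) p =
    contractR {p = p} {q = []} a∈ (□R {p = p} k (discharge {p = p} {Ψ = []} Θ js
      (subst (λ Θ′ → ⊢ 𝒟 (ctx p ((Γ ⇒ Δ) /[ k ] last (Θ′ ⇒ [ A ])))) (sym (List.++-identityʳ Θ))
        (subst (⊢ 𝒟) (ctx-∷ʳ p (Γ ⇒ Δ) k _) (⊢ₛ⇒⊢ D (p ++ [ ((Γ ⇒ Δ) , k) ]))))))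
  ⊢ₛ⇒⊢ {Γ} {Δ} (d {l = l} {j = j} {Θ = Θ} a∈ j⪯l kd js D) p =
    contractL {p = p} {q = []} a∈ (d {p = p} l j j⪯l kd (discharge {p = p} Θ js
      (subst (⊢ 𝒟) (ctx-∷ʳ p (Γ ⇒ Δ) j _) (⊢ₛ⇒⊢ D (p ++ [ ((Γ ⇒ Δ) , j) ])))))

mainTheorem4 : (𝒟 : Description) → TransitiveClosed 𝒟 → StandingAssumption 𝒟 →
    (A : Fm (Description.Idx 𝒟)) → 𝓛 𝒟 A ⇔ ⊢ 𝒟 (last ([] ⇒ A ∷ []))
mainTheorem4 𝒟 tc sa A = mk⇔ (λ h → ⊢ₛ⇒⊢ (𝓛⇒⊢ₛ h) []) ⊢⇒𝓛
  where
  open Soundness 𝒟 using (⊢⇒𝓛)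
  open HilbertToShallow 𝒟 tc sa using (𝓛⇒⊢ₛ)
  open ShallowToNested 𝒟 using (⊢ₛ⇒⊢)
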